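{- Let $\mathbf{u}$ be an infinite word over a ternary alphabet $\mathcal{A}$ with complexity $\mathcal{C}(n)=2n+1$ for every $n\in\mathbb{N}$ and with language $\mathcal{L}(\mathbf{u})$ closed under reversal. Let $p\in\mathcal{L}(\mathbf{u})$ be a palindrome with $\#\mathrm{Lext}(p)=2$ and suppose $\mathcal{P}(|p|)+\mathcal{P}(|p|+1)=4$. Then: (1) if $p$ has no palindromic extension, then $p$ is a maximal left special factor and there exists a palindrome $q\in\mathcal{L}(\mathbf{u})$ with $|q|=|p|$ that has two palindromic extensions; (2) if $p$ has two palindromic extensions, then there exists a palindrome $q\in\mathcal{L}(\mathbf{u})$ with $|q|=|p|$ that has no palindromic extension and is a maximal left special factor.
   Context: $\mathcal{L}(\mathbf{u})$ is the set of finite factors of $\mathbf{u}$, $\mathcal{L}_n(\mathbf{u})$ those of length $n$, $\mathcal{C}(n)=\#\mathcal{L}_n(\mathbf{u})$, and $\mathcal{P}(n)$ is the number of palindromic factors of length $n$. The reversal of $w=w_0\cdots w_{n-1}$ is $\overline{w}=w_{n-1}\cdots w_0$; a palindrome satisfies $w=\overline{w}$; closure under reversal means $w\in\mathcal{L}(\mathbf{u})\Rightarrow\overline{w}\in\mathcal{L}(\mathbf{u})$. $\mathrm{Lext}(w)=\{a\in\mathcal{A}: aw\in\mathcal{L}(\mathbf{u})\}$. A factor $w$ is left special if $\#\mathrm{Lext}(w)\ge 2$; a left special factor $w$ is maximal if $wc$ is not left special for any letter $c$. A palindromic extension of a palindrome $p$ is a factor $apa\in\mathcal{L}(\mathbf{u})$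 with $a\in\mathcal{A}$; "$p$ has $k$ palindromic extensions" means there are exactly $k$ such letters $a$. -}

module Defs where

open import Data.Nat using (ℕ; _+_; _*_)
open import Data.Fin using (Fin)
open import Data.List using (List; []; _∷_; _++_; [_]; length; map; upTo; reverse)
open import Data.List.Membership.Propositional using (_∈_)
open import Data.List.Relation.Unary.Unique.Propositional using (Unique)
open import Data.Product using (Σ; ∃; ∃-syntax; _×_)
open import Function.Bundles using (_⇔_)
open import Relation.Binary.PropositionalEquality using (_≡_; _≢_)
open import Relation.Nullary using (¬_)

Letter : Set
Letter = Fin 3

Word : Set
Word = List Letter

InfWord : Set
InfWord = ℕ → Letter

slice : InfWord → ℕ → ℕ → Word
slice u i n = map (λ j → u (i + j)) (upTo n)

Factor : InfWord → Word → Set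
Factor u w = ∃[ i ] slice u i (length w) ≡ w

HasCard : {A : Set} → (A → Set) → ℕ → Set
HasCard {A} P k = ∃[ xs ] (Unique xs × length xs ≡ k × (∀ x → (P x ⇔ (x ∈ xs))))

Palindrome : Word → Set
Palindrome w = reverse w ≡ w

Complexity : InfWord → ℕ → ℕ → Set
Complexity u n k = HasCard (λ w → length w ≡ n × Factor u w) k

PalCount : InfWord → ℕ → ℕ → Set
PalCount u n k = HasCard (λ w → length w ≡ n × Factor u w × Palindrome w) k

ClosedUnderReversal : InfWord → Set
ClosedUnderReversal u = ∀ w → Factor u w → Factor u (reverse w)

LextCard : InfWord → Word → ℕ → Set
LextCard u w k = HasCard (λ a → Factor u (a ∷ w)) k

LeftSpecial : InfWord → Word → Set
LeftSpecial u w = Factor u w × (∃[ a ] ∃[ b ] (a ≢ b × Factor u (a ∷ w) × Factor u (b ∷ w)))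

MaximalLeftSpecial : InfWord → Word → Set
MaximalLeftSpecial u w = LeftSpecial u w × (∀ (c : Letter) → ¬ LeftSpecial u (w ++ [ c ]))

PalExtCount : InfWord → Word → ℕ → Set
PalExtCount u p k = HasCard (λ a → Factor u (a ∷ (p ++ [ a ]))) k

-- Counting left extensions, the left valences #Lext(w) − 1 of the factors of length n add up to
-- C(n + 1) − C(n) = 2.  Hence besides p there is exactly one more left special factor s of length
-- |p|, and by closure under reversal p and the reversal of s are the only right special ones.
-- Tracking which factors of length |p| + 1 can be left special gives both parts, except in one
-- configuration per part: p and s are distinct palindromes, one of them, z₁, right special but
-- only ever extended palindromically.  There every palindrome of length |p| or |p| + 1 other than
-- p and s sits at the centre of a palindromic path in the Rauzy graph leading from p or s back to
-- itself through ordinary vertices.  Such paths are forced in both directions; none starts at z₁,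
-- since then every z₁ would leave by the same letter; at z₂ two exits cannot both be used, since
-- then z₁ would never be reached; and one exit determines the path and its centre.  Hence
-- P(|p|) + P(|p| + 1) ≤ 3 there, contradicting the hypothesis.

module Submission where

open import Defs
open import Data.Empty using (⊥; ⊥-elim)
open import Data.Fin using (Fin) renaming (_≟_ to _≟ᶠ_)
open import Data.List using (List; []; _∷_; _++_; [_]; length; map; reverse; applyUpTo; filter; allFin; initLast; _∷ʳ′_)
open import Data.List.Properties
  using (map-upTo; length-applyUpTo; unfold-reverse; length-reverse; length-++; reverse-involutive; reverse-++;
         map-++; length-map; ≡-dec; ∷-injectiveˡ; ∷ʳ-injectiveˡ; ∷ʳ-injectiveʳ)
open import Data.List.Membership.Propositional using (_∈_; _∉_; find)
open import Data.List.Membership.Propositional.Properties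
  using (∈-∃++; ∈-++⁺ˡ; ∈-++⁺ʳ; ∈-++⁻; ∈-map⁺; ∈-map⁻; ∈-filter⁺; ∈-filter⁻; ∈-allFin)
import Data.List.Membership.DecPropositional as DecMembership
open import Data.List.Relation.Unary.Any using (here; there)
open import Data.List.Relation.Unary.All as All using (all?; []; _∷_)
open import Data.List.Relation.Unary.All.Properties using (¬All⇒Any¬)
open import Data.List.Relation.Unary.AllPairs using ([]; _∷_)
open import Data.List.Relation.Unary.Unique.Propositional using (Unique)
open import Data.List.Relation.Unary.Unique.Propositional.Properties using (map⁺; ++⁺; filter⁺; allFin⁺)
open import Data.Nat
open import Data.Nat.ListAction using (sum)
open import Data.Nat.ListAction.Properties using (sum-++)
open import Data.Nat.Properties
open import Data.Nat.Tactic.RingSolver using (solve-∀)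
open import Data.Product hiding (map)
open import Data.Sum hiding (map)
open import Function using (_∘_; _$_)
open import Function.Bundles using (Equivalence; mk⇔)
open import Relation.Binary using (tri<; tri≈; tri>)
open import Relation.Binary.Definitions using (DecidableEquality)
open import Relation.Binary.PropositionalEquality hiding ([_])
open import Relation.Nullary
open import Relation.Nullary.Decidable using (_→-dec_)

-- Positions in words

-- Out of range, `at` returns the junk letter zero.
at : Word → ℕ → Letter
at [] _ = Fin.zero
at (x ∷ w) zero = x
at (x ∷ w) (suc t) = at w t

at-applyUpTo : ∀ (f : ℕ → Letter) n t → t < n → at (applyUpTo f n) t ≡ f t
at-applyUpTo f (suc n) zero lt = refl
at-applyUpTo f (suc n) (suc t) (s≤s lt) = at-applyUpTo (f ∘ suc) n t lt

at-ext : ∀ (v w : Word) → length v ≡ length w → (∀ t → t < length w → at v t ≡ at w t) → v ≡ w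
at-ext [] [] _ _ = refl
at-ext (x ∷ v) (y ∷ w) eq h =
  cong₂ _∷_ (h 0 (s≤s z≤n)) (at-ext v w (suc-injective eq) (λ t lt → h (suc t) (s≤s lt)))

at-++-< : ∀ (w : Word) y t → t < length w → at (w ++ [ y ]) t ≡ at w t
at-++-< (x ∷ w) y zero lt = refl
at-++-< (x ∷ w) y (suc t) (s≤s lt) = at-++-< w y t lt

at-++-length : ∀ (w : Word) y → at (w ++ [ y ]) (length w) ≡ y
at-++-length [] y = refl
at-++-length (x ∷ w) y = at-++-length w y

length-++-[] : ∀ (w : Word) y → length (w ++ [ y ]) ≡ suc (length w)
length-++-[] w y = trans (length-++ w) (+-comm (length w) 1)

reverse-++-[] : ∀ (w : Word) x → reverse (w ++ [ x ]) ≡ x ∷ reverse w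
reverse-++-[] w x = reverse-++ w [ x ]

<-from-sum : ∀ a b {L} → a + b + 1 ≡ L → a < L × b < L
<-from-sum a b refl =
  subst (a <_) (+-comm 1 (a + b)) (s≤s (m≤m+n a b)) ,
  subst (b <_) (+-comm 1 (a + b)) (s≤s (m≤n+m b a))

+-complement : ∀ {t L} → t < L → t + (L ∸ suc t) + 1 ≡ L
+-complement {t} {L} t<L = trans (+-comm (t + (L ∸ suc t)) 1) (m+[n∸m]≡n t<L)

at-reverse : ∀ (w : Word) a b → a + b + 1 ≡ length w → at (reverse w) a ≡ at w b
at-reverse [] a b eq = ⊥-elim (1+n≢0 (trans (+-comm 1 (a + b)) eq))
at-reverse (x ∷ w) a zero eq = begin
  at (reverse (x ∷ w)) a           ≡⟨ cong (λ v → at v a) (unfold-reverse x w) ⟩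
  at (reverse w ++ [ x ]) a        ≡⟨ cong (at (reverse w ++ [ x ])) a≡ ⟩
  at (reverse w ++ [ x ]) (length (reverse w)) ≡⟨ at-++-length (reverse w) x ⟩
  x                                ∎
  where
  open ≡-Reasoning
  a≡ : a ≡ length (reverse w)
  a≡ = trans (suc-injective (trans (+-comm 1 a) (trans (cong (_+ 1) (sym (+-identityʳ a))) eq)))
             (sym (length-reverse w))
at-reverse (x ∷ w) a (suc b) eq = begin
  at (reverse (x ∷ w)) a    ≡⟨ cong (λ v → at v a) (unfold-reverse x w) ⟩
  at (reverse w ++ [ x ]) a ≡⟨ at-++-< (reverse w) x a a<∣w∣ ⟩
  at (reverse w) a          ≡⟨ at-reverse w a b eq′ ⟩
  at w b                    ∎
  where
  open ≡-Reasoning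
  eq′ : a + b + 1 ≡ length w
  eq′ = suc-injective (trans (sym (cong (_+ 1) (+-suc a b))) eq)
  a<∣w∣ : a < length (reverse w)
  a<∣w∣ = subst (a <_) (sym (length-reverse w)) (proj₁ (<-from-sum a b eq′))

palindrome-at : ∀ (w : Word) → Palindrome w → ∀ a b → a + b + 1 ≡ length w → at w a ≡ at w b
palindrome-at w pw a b eq = trans (cong (λ v → at v a) (sym pw)) (at-reverse w a b eq)

-- Occurrences in the infinite word

module _ (u : InfWord) where

  length-slice : ∀ i n → length (slice u i n) ≡ n
  length-slice i n = trans (cong length (map-upTo (λ j → u (i + j)) n)) (length-applyUpTo _ n)

  at-slice : ∀ i n t → t < n → at (slice u i n) t ≡ u (i + t)
  at-slice i n t lt = trans (cong (λ v → at v t) (map-upTo (λ j → u (i + j)) n)) (at-applyUpTo _ n t lt)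

  OccursAt : ℕ → Word → Set
  OccursAt i w = ∀ t → t < length w → u (i + t) ≡ at w t

  occurs⇒slice : ∀ i w → OccursAt i w → slice u i (length w) ≡ w
  occurs⇒slice i w o = at-ext _ w (length-slice i (length w)) (λ t lt → trans (at-slice i _ t lt) (o t lt))

  occurs⇒factor : ∀ i w → OccursAt i w → Factor u w
  occurs⇒factor i w o = i , occurs⇒slice i w o

  factor⇒occurs : ∀ w → Factor u w → ∃[ i ] OccursAt i w
  factor⇒occurs w (i , eq) = i , λ t lt → trans (sym (at-slice i _ t lt)) (cong (λ v → at v t) eq)

  occurs-slice : ∀ n k → OccursAt k (slice u k n)
  occurs-slice n k t lt = sym (at-slice k n t (subst (t <_) (length-slice k n) lt))

  occurs-tail : ∀ i x w → OccursAt i (x ∷ w) → OccursAt (suc i) w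
  occurs-tail i x w o t lt = trans (cong u (sym (+-suc i t))) (o (suc t) (s≤s lt))

  occurs-init : ∀ i w y → OccursAt i (w ++ [ y ]) → OccursAt i w
  occurs-init i w y o t lt =
    trans (o t (subst (t <_) (sym (length-++-[] w y)) (m≤n⇒m≤1+n lt))) (at-++-< w y t lt)

  occurs-last : ∀ i w y → OccursAt i (w ++ [ y ]) → u (i + length w) ≡ y
  occurs-last i w y o =
    trans (o (length w) (subst (length w <_) (sym (length-++-[] w y)) (n<1+n _))) (at-++-length w y)

  occurs-++-next : ∀ i w → OccursAt i w → OccursAt i (w ++ [ u (i + length w) ])
  occurs-++-next i w o t lt with <-cmp t (length w)
  ... | tri< t<∣w∣ _ _ = trans (o t t<∣w∣) (sym (at-++-< w _ t t<∣w∣))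
  ... | tri≈ _ refl _ = sym (at-++-length w _)
  ... | tri> _ _ t>∣w∣ = ⊥-elim (<⇒≱ (subst (t <_) (length-++-[] w _) lt) t>∣w∣)

  occurs-previous-∷ : ∀ i w → OccursAt (suc i) w → OccursAt i (u i ∷ w)
  occurs-previous-∷ i w o zero lt = cong u (+-identityʳ i)
  occurs-previous-∷ i w o (suc t) (s≤s lt) = trans (cong u (+-suc i t)) (o t lt)

  Mirror : ℕ → ℕ → ℕ → Set
  Mirror i j L = ∀ a b → a + b + 1 ≡ L → u (j + a) ≡ u (i + b)

  factor-tail : ∀ x w → Factor u (x ∷ w) → Factor u w
  factor-tail x w f = let i , o = factor⇒occurs _ f in occurs⇒factor _ w (occurs-tail i x w o)

  factor-init : ∀ w y → Factor u (w ++ [ y ]) → Factor u w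
  factor-init w y f = let i , o = factor⇒occurs _ f in occurs⇒factor _ w (occurs-init i w y o)

  factor-rightExtension : ∀ w → Factor u w → ∃[ y ] Factor u (w ++ [ y ])
  factor-rightExtension w f =
    let i , o = factor⇒occurs _ f in _ , occurs⇒factor i _ (occurs-++-next i w o)

module _ (u : InfWord) (closed : ClosedUnderReversal u) where

  factor-leftExtension : ∀ w → Factor u w → ∃[ x ] Factor u (x ∷ w)
  factor-leftExtension w f =
    let x , f′ = factor-rightExtension u (reverse w) (closed w f) in
    x , subst (Factor u) (trans (reverse-++-[] (reverse w) x) (cong (x ∷_) (reverse-involutive w))) (closed _ f′)

  palindrome-rightExt⇒leftExt : ∀ x (p : Word) → Palindrome p → Factor u (p ++ [ x ]) → Factor u (x ∷ p)
  palindrome-rightExt⇒leftExt x p pp f = subst (Factor u) (trans (reverse-++-[] p x) (cong (x ∷_) pp)) (closed _ f)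

  palindrome-swapExt : ∀ x (p : Word) y → Palindrome p → Factor u (x ∷ (p ++ [ y ])) → Factor u (y ∷ (p ++ [ x ]))
  palindrome-swapExt x p y pp f = subst (Factor u) rev (closed _ f)
    where
    rev : reverse (x ∷ (p ++ [ y ])) ≡ y ∷ (p ++ [ x ])
    rev = trans (unfold-reverse x (p ++ [ y ]))
                (cong (_++ [ x ]) (trans (reverse-++-[] p y) (cong (y ∷_) pp)))

  reversed-slice : ∀ i L → ∃[ j ] Mirror u i j L
  reversed-slice i L =
    let j , o = factor⇒occurs u (reverse w) (closed w (occurs⇒factor u i w (occurs-slice u L i))) in
    j , λ a b eq →
      let a< , b< = <-from-sum a b (trans eq (sym ∣w∣)) in
      trans (o a (subst (a <_) (sym (length-reverse w)) a<))
            (trans (at-reverse w a b (trans eq (sym ∣w∣))) (sym (occurs-slice u L i b b<)))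
    where
    w = slice u i L
    ∣w∣ : length w ≡ L
    ∣w∣ = length-slice u i L

UniqueLeftExt : InfWord → Word → Set
UniqueLeftExt u v = ∀ x y → Factor u (x ∷ v) → Factor u (y ∷ v) → x ≡ y

UniqueRightExt : InfWord → Word → Set
UniqueRightExt u v = ∀ x y → Factor u (v ++ [ x ]) → Factor u (v ++ [ y ]) → x ≡ y

-- Counting in duplicate-free lists

module _ {A : Set} where

  sum-map-++ : ∀ (g : A → ℕ) xs ys → sum (map g (xs ++ ys)) ≡ sum (map g xs) + sum (map g ys)
  sum-map-++ g xs ys = trans (cong sum (map-++ g xs ys)) (sum-++ (map g xs) (map g ys))

  sum-map-middle : ∀ (g : A → ℕ) xs y ys → sum (map g (xs ++ [ y ] ++ ys)) ≡ g y + sum (map g (xs ++ ys))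
  sum-map-middle g xs y ys = begin
    sum (map g (xs ++ y ∷ ys))         ≡⟨ sum-map-++ g xs (y ∷ ys) ⟩
    Σxs + (g y + Σys)                  ≡⟨ arith Σxs (g y) Σys ⟩
    g y + (Σxs + Σys)                  ≡⟨ cong (g y +_) (sym (sum-map-++ g xs ys)) ⟩
    g y + sum (map g (xs ++ ys))       ∎
    where
    open ≡-Reasoning
    Σxs = sum (map g xs)
    Σys = sum (map g ys)
    arith : ∀ a b c → a + (b + c) ≡ b + (a + c)
    arith = solve-∀

  ∈-++-remove : ∀ xs (y : A) ys {v} → v ∈ xs ++ [ y ] ++ ys → v ≢ y → v ∈ xs ++ ys
  ∈-++-remove [] y ys (here eq) v≢y = ⊥-elim (v≢y eq)
  ∈-++-remove [] y ys (there v∈) v≢y = v∈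
  ∈-++-remove (x ∷ xs) y ys (here eq) v≢y = here eq
  ∈-++-remove (x ∷ xs) y ys (there v∈) v≢y = there (∈-++-remove xs y ys v∈ v≢y)

  sum-map-mono : ∀ (g : A → ℕ) ys zs → Unique ys → (∀ v → v ∈ ys → 0 < g v → v ∈ zs) →
                 sum (map g ys) ≤ sum (map g zs)
  sum-map-mono g [] zs _ _ = z≤n
  sum-map-mono g (y ∷ ys) zs (y∉ys ∷ !ys) cover with g y in gy
  ... | zero = sum-map-mono g ys zs !ys (λ v v∈ → cover v (there v∈))
  ... | suc k with ∈-∃++ (cover y (here refl) (subst (0 <_) (sym gy) (s≤s z≤n)))
  ... | xs , xs′ , refl = begin
    suc k + sum (map g ys)                 ≡⟨ cong (_+ sum (map g ys)) gy ⟨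
    g y + sum (map g ys)                   ≤⟨ +-monoʳ-≤ (g y) (sum-map-mono g ys (xs ++ xs′) !ys cover′) ⟩
    g y + sum (map g (xs ++ xs′))          ≡⟨ sum-map-middle g xs y xs′ ⟨
    sum (map g (xs ++ [ y ] ++ xs′))       ∎
    where
    open ≤-Reasoning
    cover′ : ∀ v → v ∈ ys → 0 < g v → v ∈ xs ++ xs′
    cover′ v v∈ pos = ∈-++-remove xs y xs′ (cover v (there v∈) pos) (λ v≡y → All.lookup y∉ys v∈ (sym v≡y))

  sum-map-pred : ∀ (f : A → ℕ) ws → (∀ w → w ∈ ws → 1 ≤ f w) →
                 sum (map f ws) ≡ sum (map (λ w → f w ∸ 1) ws) + length ws
  sum-map-pred f [] _ = refl
  sum-map-pred f (w ∷ ws) pos = begin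
    f w + sum (map f ws)                           ≡⟨ cong₂ _+_ (m∸n+n≡m (pos w (here refl)))
                                                               (sym (sum-map-pred f ws (λ v v∈ → pos v (there v∈)))) ⟨
    (f w ∸ 1) + 1 + (sum (map (λ w → f w ∸ 1) ws) + length ws) ≡⟨ arith (f w ∸ 1) _ (length ws) ⟩
    (f w ∸ 1) + sum (map (λ w → f w ∸ 1) ws) + suc (length ws) ∎
    where
    open ≡-Reasoning
    arith : ∀ a b c → a + 1 + (b + c) ≡ a + b + suc c
    arith = solve-∀

  sum-map-const : ∀ (xs : List A) → sum (map (λ _ → 1) xs) ≡ length xs
  sum-map-const [] = refl
  sum-map-const (x ∷ xs) = cong suc (sum-map-const xs)

  length-mono : ∀ (ys zs : List A) → Unique ys → (∀ v → v ∈ ys → v ∈ zs) → length ys ≤ length zs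
  length-mono ys zs !ys ys⊆zs =
    subst₂ _≤_ (sum-map-const ys) (sum-map-const zs) (sum-map-mono (λ _ → 1) ys zs !ys (λ v v∈ _ → ys⊆zs v v∈))

module _ {A : Set} (_≟_ : DecidableEquality A) where

  open DecMembership _≟_ using (_∈?_)

  private
    covered? : ∀ (g : A → ℕ) zs v → Dec (0 < g v → v ∈ zs)
    covered? g zs v = 0 <? g v →-dec v ∈? zs

  sum-map-<⇒∃ : ∀ (g : A → ℕ) ys zs → Unique ys → sum (map g zs) < sum (map g ys) →
                ∃[ v ] v ∈ ys × v ∉ zs × 0 < g v
  sum-map-<⇒∃ g ys zs !ys lt with all? (covered? g zs) ys
  ... | yes cover = ⊥-elim (<⇒≱ lt (sum-map-mono g ys zs !ys (λ v v∈ → All.lookup cover v∈)))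
  ... | no ¬cover with find (¬All⇒Any¬ (covered? g zs) ys ¬cover)
  ... | v , v∈ , ¬covered with v ∈? zs | 0 <? g v
  ...   | yes v∈zs | _ = ⊥-elim (¬covered (λ _ → v∈zs))
  ...   | no v∉zs | yes pos = v , v∈ , v∉zs , pos
  ...   | no _ | no ¬pos = ⊥-elim (¬covered (λ pos → ⊥-elim (¬pos pos)))

  ∃-∈-∉ : ∀ (xs zs : List A) → Unique xs → length zs < length xs → ∃[ x ] x ∈ xs × x ∉ zs
  ∃-∈-∉ xs zs !xs lt =
    let x , x∈ , x∉ , _ = sum-map-<⇒∃ (λ _ → 1) xs zs !xs (subst₂ _<_ (sym (sum-map-const zs)) (sym (sum-map-const xs)) lt)
    in x , x∈ , x∉

+-double-injective : ∀ {a b} → a + a ≡ b + b → a ≡ b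
+-double-injective {a} {b} eq = trans (n≡⌊n+n/2⌋ a) (trans (cong ⌊_/2⌋ eq) (sym (n≡⌊n+n/2⌋ b)))

+-double : ∀ k → k + k ≡ 2 * k
+-double k = cong (k +_) (sym (+-identityʳ k))

parity-split : ∀ δ ε k l → δ ≤ 1 → ε ≤ 1 → δ + (k + k) ≡ ε + (l + l) → δ ≡ ε × k ≡ l
parity-split zero zero k l _ _ eq = refl , +-double-injective eq
parity-split (suc zero) (suc zero) k l _ _ eq = refl , +-double-injective (suc-injective eq)
parity-split zero (suc zero) k l _ _ eq = ⊥-elim (even≢odd k l (trans (sym (+-double k)) (trans eq (cong suc (+-double l)))))
parity-split (suc zero) zero k l _ _ eq = ⊥-elim (even≢odd l k (trans (sym (+-double l)) (trans (sym eq) (cong suc (+-double k)))))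
parity-split (suc (suc _)) _ _ _ (s≤s ()) _ _
parity-split _ (suc (suc _)) _ _ _ (s≤s ()) _

record Listing {A : Set} (P : A → Set) (k : ℕ) : Set where
  field
    elems    : List A
    unique   : Unique elems
    length≡  : length elems ≡ k
    complete : ∀ x → P x → x ∈ elems
    sound    : ∀ x → x ∈ elems → P x

listing : ∀ {A : Set} {P : A → Set} {k} → HasCard P k → Listing P k
listing (xs , !xs , ∣xs∣ , P⇔∈) = record
  { elems = xs ; unique = !xs ; length≡ = ∣xs∣
  ; complete = λ x → Equivalence.to (P⇔∈ x) ; sound = λ x → Equivalence.from (P⇔∈ x) }

HasCard-0⁻ : ∀ {A : Set} {P : A → Set} → HasCard P 0 → ∀ x → ¬ P x
HasCard-0⁻ ([] , _ , _ , P⇔∈) x px with () ← Equivalence.to (P⇔∈ x) px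

HasCard-2⁻ : ∀ {P : Letter → Set} → HasCard P 2 →
            ∃[ a ] ∃[ b ] a ≢ b × P a × P b × (∀ x → P x → x ≡ a ⊎ x ≡ b)
HasCard-2⁻ ((a ∷ b ∷ []) , (a≢b ∷ []) ∷ _ , refl , P⇔∈) =
  a , b , a≢b , from (here refl) , from (there (here refl)) , λ x px → pair (Equivalence.to (P⇔∈ x) px)
  where
  from = λ {x} → Equivalence.from (P⇔∈ x)
  pair : ∀ {x} → x ∈ a ∷ b ∷ [] → x ≡ a ⊎ x ≡ b
  pair (here x≡a) = inj₁ x≡a
  pair (there (here x≡b)) = inj₂ x≡b

HasCard-0⁺ : ∀ {A : Set} {P : A → Set} → (∀ x → ¬ P x) → HasCard P 0
HasCard-0⁺ none = [] , [] , refl , λ x → mk⇔ (⊥-elim ∘ none x) (λ ())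

HasCard-2⁺ : ∀ {P : Letter → Set} {a b} → a ≢ b → P a → P b → (∀ x → P x → x ≡ a ⊎ x ≡ b) → HasCard P 2
HasCard-2⁺ {a = a} {b} a≢b pa pb pair = a ∷ b ∷ [] , (a≢b ∷ []) ∷ [] ∷ [] , refl , λ x → mk⇔ (to x) from
  where
  to : ∀ x → _ → x ∈ a ∷ b ∷ []
  to x px with pair x px
  ... | inj₁ refl = here refl
  ... | inj₂ refl = there (here refl)
  from : ∀ {x} → x ∈ a ∷ b ∷ [] → _
  from (here refl) = pa
  from (there (here refl)) = pb

_≟ʷ_ : DecidableEquality Word
_≟ʷ_ = ≡-dec _≟ᶠ_

LeftExtIn : InfWord → Word → Letter → Letter → Set
LeftExtIn u v a b = ∀ x → Factor u (x ∷ v) → x ≡ a ⊎ x ≡ b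

pair-exhausted : ∀ {x x′ e a b : Letter} → x ≢ x′ → x ≡ a ⊎ x ≡ b → x′ ≡ a ⊎ x′ ≡ b →
                 e ≡ a ⊎ e ≡ b → e ≡ x ⊎ e ≡ x′
pair-exhausted x≢x′ (inj₁ refl) (inj₁ refl) _ = ⊥-elim (x≢x′ refl)
pair-exhausted x≢x′ (inj₂ refl) (inj₂ refl) _ = ⊥-elim (x≢x′ refl)
pair-exhausted _ (inj₁ refl) (inj₂ refl) (inj₁ refl) = inj₁ refl
pair-exhausted _ (inj₁ refl) (inj₂ refl) (inj₂ refl) = inj₂ refl
pair-exhausted _ (inj₂ refl) (inj₁ refl) (inj₁ refl) = inj₂ refl
pair-exhausted _ (inj₂ refl) (inj₁ refl) (inj₂ refl) = inj₁ refl

pair-exhausted-by : ∀ {x x′ a b : Letter} (P : Letter → Set) → x ≢ x′ → x ≡ a ⊎ x ≡ b → x′ ≡ a ⊎ x′ ≡ b →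
                    P x → P x′ → P a × P b
pair-exhausted-by P x≢x′ (inj₁ refl) (inj₁ refl) _ _ = ⊥-elim (x≢x′ refl)
pair-exhausted-by P x≢x′ (inj₂ refl) (inj₂ refl) _ _ = ⊥-elim (x≢x′ refl)
pair-exhausted-by P _ (inj₁ refl) (inj₂ refl) px px′ = px , px′
pair-exhausted-by P _ (inj₂ refl) (inj₁ refl) px px′ = px′ , px

-- The left valence of a factor w of length m is #Lext(w) − 1.  Since every factor is
-- left extendable, summing #Lext over L_m counts L_{m+1}, so the valences add up to
-- C(m+1) − C(m) = 2.
module LeftValence (u : InfWord) (closed : ClosedUnderReversal u)
                   (complexity : ∀ n → Complexity u n (2 * n + 1)) (m : ℕ) where

  private
    module X = Listing (listing (complexity m))
    module Y = Listing (listing (complexity (suc m)))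
    open DecMembership _≟ʷ_ using (_∈?_)

    extends? : ∀ w a → Dec ((a ∷ w) ∈ Y.elems)
    extends? w a = (a ∷ w) ∈? Y.elems

    leftExt : Word → List Letter
    leftExt w = filter (extends? w) (allFin 3)

    valence : Word → ℕ
    valence w = length (leftExt w) ∸ 1

    leftExt-unique : ∀ w → Unique (leftExt w)
    leftExt-unique w = filter⁺ (extends? w) (allFin⁺ 3)

    ∈-leftExt⁺ : ∀ w a → length w ≡ m → Factor u (a ∷ w) → a ∈ leftExt w
    ∈-leftExt⁺ w a ∣w∣ fa = ∈-filter⁺ (extends? w) (∈-allFin a) (Y.complete _ (cong suc ∣w∣ , fa))

    ∈-leftExt⁻ : ∀ w a → a ∈ leftExt w → Factor u (a ∷ w)
    ∈-leftExt⁻ w a a∈ = proj₂ (Y.sound _ (proj₂ (∈-filter⁻ (extends? w) {xs = allFin 3} a∈)))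

    extensions : List Word → List Word
    extensions [] = []
    extensions (w ∷ ws) = map (_∷ w) (leftExt w) ++ extensions ws

    ∈-extensions⁻ : ∀ ws v → v ∈ extensions ws → ∃[ a ] ∃[ w ] v ≡ a ∷ w × w ∈ ws × a ∈ leftExt w
    ∈-extensions⁻ (w ∷ ws) v v∈ with ∈-++⁻ (map (_∷ w) (leftExt w)) v∈
    ... | inj₁ v∈here = let a , a∈ , v≡ = ∈-map⁻ (_∷ w) v∈here in a , w , v≡ , here refl , a∈
    ... | inj₂ v∈rest = let a , w′ , v≡ , w′∈ , a∈ = ∈-extensions⁻ ws v v∈rest in a , w′ , v≡ , there w′∈ , a∈

    ∈-extensions⁺ : ∀ ws w a → w ∈ ws → a ∈ leftExt w → (a ∷ w) ∈ extensions ws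
    ∈-extensions⁺ (w ∷ ws) w a (here refl) a∈ = ∈-++⁺ˡ (∈-map⁺ (_∷ w) a∈)
    ∈-extensions⁺ (w′ ∷ ws) w a (there w∈) a∈ = ∈-++⁺ʳ (map (_∷ w′) (leftExt w′)) (∈-extensions⁺ ws w a w∈ a∈)

    extensions-unique : ∀ ws → Unique ws → Unique (extensions ws)
    extensions-unique [] _ = []
    extensions-unique (w ∷ ws) (w∉ws ∷ !ws) =
      ++⁺ (map⁺ ∷-injectiveˡ (leftExt-unique w)) (extensions-unique ws !ws) disjoint
      where
      disjoint : ∀ {v} → ¬ (v ∈ map (_∷ w) (leftExt w) × v ∈ extensions ws)
      disjoint (v∈here , v∈rest) with ∈-map⁻ (_∷ w) v∈here | ∈-extensions⁻ ws _ v∈rest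
      ... | _ , _ , refl | _ , _ , refl , w∈ws , _ = All.lookup w∉ws w∈ws refl

    length-extensions : ∀ ws → length (extensions ws) ≡ sum (map (length ∘ leftExt) ws)
    length-extensions [] = refl
    length-extensions (w ∷ ws) =
      trans (length-++ (map (_∷ w) (leftExt w))) (cong₂ _+_ (length-map _ (leftExt w)) (length-extensions ws))

    sum-length-leftExt : sum (map (length ∘ leftExt) X.elems) ≡ 2 * m + 3
    sum-length-leftExt = begin
      sum (map (length ∘ leftExt) X.elems) ≡⟨ length-extensions X.elems ⟨
      length (extensions X.elems)          ≡⟨ ≤-antisym (length-mono _ _ (extensions-unique _ X.unique) ext⊆Y)
                                                          (length-mono _ _ Y.unique Y⊆ext) ⟩
      length Y.elems                       ≡⟨ Y.length≡ ⟩
      2 * suc m + 1                        ≡⟨ arith m ⟩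
      2 * m + 3                            ∎
      where
      open ≡-Reasoning
      arith : ∀ m → 2 * suc m + 1 ≡ 2 * m + 3
      arith = solve-∀
      ext⊆Y : ∀ v → v ∈ extensions X.elems → v ∈ Y.elems
      ext⊆Y v v∈ with ∈-extensions⁻ X.elems v v∈
      ... | a , w , refl , _ , a∈ = proj₂ (∈-filter⁻ (extends? w) {xs = allFin 3} a∈)
      Y⊆ext : ∀ v → v ∈ Y.elems → v ∈ extensions X.elems
      Y⊆ext [] v∈ with () ← proj₁ (Y.sound [] v∈)
      Y⊆ext (a ∷ w) v∈ =
        let ∣v∣ , fv = Y.sound _ v∈ in
        ∈-extensions⁺ X.elems w a (X.complete w (suc-injective ∣v∣ , factor-tail u a w fv))
                      (∈-filter⁺ (extends? w) (∈-allFin a) v∈)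

    leftExt-nonempty : ∀ w → w ∈ X.elems → 1 ≤ length (leftExt w)
    leftExt-nonempty w w∈ with X.sound w w∈
    ... | ∣w∣ , fw with factor-leftExtension u closed w fw
    ... | a , fa with leftExt w | ∈-leftExt⁺ w a ∣w∣ fa
    ... | _ ∷ _ | _ = s≤s z≤n

    sum-valence : sum (map valence X.elems) ≡ 2
    sum-valence = +-cancelʳ-≡ (length X.elems) _ 2 (begin
      sum (map valence X.elems) + length X.elems ≡⟨ sum-map-pred (length ∘ leftExt) X.elems leftExt-nonempty ⟨
      sum (map (length ∘ leftExt) X.elems)       ≡⟨ sum-length-leftExt ⟩
      2 * m + 3                                  ≡⟨ arith m ⟩
      2 + (2 * m + 1)                            ≡⟨ cong (2 +_) X.length≡ ⟨
      2 + length X.elems                         ∎)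
      where
      open ≡-Reasoning
      arith : ∀ m → 2 * m + 3 ≡ 2 + (2 * m + 1)
      arith = solve-∀

    sum-valence-≤ : ∀ ws → Unique ws → (∀ w → w ∈ ws → length w ≡ m × Factor u w) → sum (map valence ws) ≤ 2
    sum-valence-≤ ws !ws ws⊆ = subst (sum (map valence ws) ≤_) sum-valence
      (sum-map-mono valence ws X.elems !ws (λ w w∈ _ → X.complete w (ws⊆ w w∈)))

    leftSpecial⇒valence≥1 : ∀ w → length w ≡ m → LeftSpecial u w → 1 ≤ valence w
    leftSpecial⇒valence≥1 w ∣w∣ (_ , a , b , a≢b , fa , fb) =
      ∸-monoˡ-≤ 1 (length-mono (a ∷ b ∷ []) (leftExt w) ((a≢b ∷ []) ∷ [] ∷ [])
        λ { x (here refl) → ∈-leftExt⁺ w a ∣w∣ fa ; x (there (here refl)) → ∈-leftExt⁺ w b ∣w∣ fb })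

    valence≥1⇒leftSpecial : ∀ w → Factor u w → 1 ≤ valence w → LeftSpecial u w
    valence≥1⇒leftSpecial w fw pos with leftExt w | leftExt-unique w | ∈-leftExt⁻ w
    ... | a ∷ b ∷ _ | (a≢b ∷ _) ∷ _ | sound = fw , a , b , a≢b , sound a (here refl) , sound b (there (here refl))

    leftExtIn⇒valence≤1 : ∀ w a b → LeftExtIn u w a b → valence w ≤ 1
    leftExtIn⇒valence≤1 w a b within =
      ∸-monoˡ-≤ 1 (length-mono (leftExt w) (a ∷ b ∷ []) (leftExt-unique w) λ x x∈ → pair (within x (∈-leftExt⁻ w x x∈)))
      where
      pair : ∀ {x} → x ≡ a ⊎ x ≡ b → x ∈ a ∷ b ∷ []
      pair (inj₁ refl) = here refl
      pair (inj₂ refl) = there (here refl)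

    valence≤1⇒leftExtIn : ∀ w a b → length w ≡ m → valence w ≤ 1 →
                          Factor u (a ∷ w) → Factor u (b ∷ w) → a ≢ b → LeftExtIn u w a b
    valence≤1⇒leftExtIn w a b ∣w∣ val≤1 fa fb a≢b x fx with x ≟ᶠ a | x ≟ᶠ b
    ... | yes x≡a | _ = inj₁ x≡a
    ... | no _ | yes x≡b = inj₂ x≡b
    ... | no x≢a | no x≢b = ⊥-elim (<⇒≱ (∸-monoˡ-≤ 1 three≤) val≤1)
      where
      three≤ : 3 ≤ length (leftExt w)
      three≤ = length-mono (a ∷ b ∷ x ∷ []) (leftExt w)
                 ((a≢b ∷ (x≢a ∘ sym) ∷ []) ∷ ((x≢b ∘ sym) ∷ []) ∷ [] ∷ [])
                 λ { y (here refl) → ∈-leftExt⁺ w a ∣w∣ fa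
                   ; y (there (here refl)) → ∈-leftExt⁺ w b ∣w∣ fb
                   ; y (there (there (here refl))) → ∈-leftExt⁺ w x ∣w∣ fx }

    valence≡0⇒uniqueLeftExt : ∀ w → length w ≡ m → valence w ≡ 0 → UniqueLeftExt u w
    valence≡0⇒uniqueLeftExt w ∣w∣ val≡0 a b fa fb with a ≟ᶠ b
    ... | yes a≡b = a≡b
    ... | no a≢b = ⊥-elim (<-irrefl (sym val≡0) (leftSpecial⇒valence≥1 w ∣w∣ (factor-tail u a w fa , a , b , a≢b , fa , fb)))

  abstract
    leftSpecial-exists : ∃[ v ] length v ≡ m × LeftSpecial u v
    leftSpecial-exists =
      let v , v∈ , _ , pos = sum-map-<⇒∃ _≟ʷ_ valence X.elems [] X.unique (subst (0 <_) (sym sum-valence) (s≤s z≤n))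
          ∣v∣ , fv = X.sound v v∈
      in v , ∣v∣ , valence≥1⇒leftSpecial v fv pos

    leftSpecial-another : ∀ v a b → LeftExtIn u v a b → ∃[ v′ ] v′ ≢ v × length v′ ≡ m × LeftSpecial u v′
    leftSpecial-another v a b within =
      let v′ , v′∈ , v′∉ , pos = sum-map-<⇒∃ _≟ʷ_ valence X.elems (v ∷ []) X.unique
                                   (subst (valence v + 0 <_) (sym sum-valence) (s≤s (+-monoˡ-≤ 0 (leftExtIn⇒valence≤1 v a b within))))
          ∣v′∣ , fv′ = X.sound v′ v′∈
      in v′ , (λ v′≡v → v′∉ (here v′≡v)) , ∣v′∣ , valence≥1⇒leftSpecial v′ fv′ pos

  module _ {v₁ v₂ : Word} (v₁≢v₂ : v₁ ≢ v₂) (∣v₁∣ : length v₁ ≡ m) (∣v₂∣ : length v₂ ≡ m)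
           (ls₁ : LeftSpecial u v₁) (ls₂ : LeftSpecial u v₂) where

    leftSpecial-pair⇒leftExtIn : ∀ a b → a ≢ b → Factor u (a ∷ v₁) → Factor u (b ∷ v₁) → LeftExtIn u v₁ a b
    leftSpecial-pair⇒leftExtIn a b a≢b fa fb = valence≤1⇒leftExtIn v₁ a b ∣v₁∣ val≤1 fa fb a≢b
      where
      sum≤2 : valence v₁ + (valence v₂ + 0) ≤ 2
      sum≤2 = sum-valence-≤ (v₁ ∷ v₂ ∷ []) ((v₁≢v₂ ∷ []) ∷ [] ∷ [])
                λ { w (here refl) → ∣v₁∣ , proj₁ ls₁ ; w (there (here refl)) → ∣v₂∣ , proj₁ ls₂ }
      val≤1 : valence v₁ ≤ 1
      val≤1 = +-cancelʳ-≤ 1 (valence v₁) 1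
                (≤-trans (+-monoʳ-≤ (valence v₁) (+-monoˡ-≤ 0 (leftSpecial⇒valence≥1 v₂ ∣v₂∣ ls₂))) sum≤2)

    leftSpecial-pair⇒uniqueLeftExt : ∀ w → length w ≡ m → Factor u w → w ≢ v₁ → w ≢ v₂ → UniqueLeftExt u w
    leftSpecial-pair⇒uniqueLeftExt w ∣w∣ fw w≢v₁ w≢v₂ = valence≡0⇒uniqueLeftExt w ∣w∣ val≡0
      where
      sum≤2 : valence v₁ + (valence v₂ + (valence w + 0)) ≤ 2
      sum≤2 = sum-valence-≤ (v₁ ∷ v₂ ∷ w ∷ [])
                ((v₁≢v₂ ∷ (w≢v₁ ∘ sym) ∷ []) ∷ ((w≢v₂ ∘ sym) ∷ []) ∷ [] ∷ [])
                λ { x (here refl) → ∣v₁∣ , proj₁ ls₁ ; x (there (here refl)) → ∣v₂∣ , proj₁ ls₂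
                  ; x (there (there (here refl))) → ∣w∣ , fw }
      val≡0 : valence w ≡ 0
      val≡0 = n≤0⇒n≡0 (+-cancelˡ-≤ 2 (valence w) 0 (≤-trans two+val≤ sum≤2))
        where
        two+val≤ : 2 + valence w ≤ valence v₁ + (valence v₂ + (valence w + 0))
        two+val≤ = +-mono-≤ (leftSpecial⇒valence≥1 v₁ ∣v₁∣ ls₁)
                     (+-mono-≤ (leftSpecial⇒valence≥1 v₂ ∣v₂∣ ls₂) (≤-reflexive (sym (+-identityʳ _))))

module _ (P : ℕ → Set) (P? : ∀ k → Dec (P k)) where

  private
    search : ∀ k → (∀ j → j < k → ¬ P j) ⊎ (∃[ m ] P m × m < k × (∀ j → j < m → ¬ P j))
    search zero = inj₁ λ _ ()
    search (suc k) with search k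
    ... | inj₂ (m , pm , m<k , below) = inj₂ (m , pm , m≤n⇒m≤1+n m<k , below)
    ... | inj₁ none with P? k
    ...   | yes pk = inj₂ (k , pk , n<1+n k , none)
    ...   | no ¬pk = inj₁ λ j j<1+k → [ none j , (λ { refl → ¬pk }) ]′ (m≤n⇒m<n∨m≡n (≤-pred j<1+k))

  least : ∀ k → P k → ∃[ m ] P m × m ≤ k × (∀ j → j < m → ¬ P j)
  least k pk with search (suc k)
  ... | inj₁ none = ⊥-elim (none k (n<1+n k) pk)
  ... | inj₂ (m , pm , m<1+k , below) = m , pm , ≤-pred m<1+k , below

  greatest : ∀ a k → P a → a ≤ k → ∃[ m ] a ≤ m × m ≤ k × P m × (∀ j → m < j → j ≤ k → ¬ P j)
  greatest a k pa a≤k with P? k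
  ... | yes pk = k , a≤k , ≤-refl , pk , λ j k<j j≤k → ⊥-elim (<⇒≱ k<j j≤k)
  greatest a zero pa z≤n | no ¬p0 = ⊥-elim (¬p0 pa)
  greatest a (suc k) pa a≤1+k | no ¬pk with m≤n⇒m<n∨m≡n a≤1+k
  ... | inj₂ refl = ⊥-elim (¬pk pa)
  ... | inj₁ a≤k with greatest a k pa (≤-pred a≤k)
  ...   | m , a≤m , m≤k , pm , above = m , a≤m , m≤n⇒m≤1+n m≤k , pm , above′
    where
    above′ : ∀ j → m < j → j ≤ suc k → ¬ P j
    above′ j m<j j≤1+k = [ (λ j<1+k → above j m<j (≤-pred j<1+k)) , (λ { refl → ¬pk }) ]′ (m≤n⇒m<n∨m≡n j≤1+k)

-- Windows of the infinite word

module _ (u : InfWord) where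

  Agree : ℕ → ℕ → ℕ → Set
  Agree i j K = ∀ r → r < K → u (i + r) ≡ u (j + r)

  agree-sym : ∀ {i j K} → Agree i j K → Agree j i K
  agree-sym agree r lt = sym (agree r lt)

  agree-≤ : ∀ {i j K K′} → K′ ≤ K → Agree i j K → Agree i j K′
  agree-≤ le agree r lt = agree r (<-≤-trans lt le)

  agree-shift : ∀ {i j K} t L → t + L ≤ K → Agree i j K → Agree (i + t) (j + t) L
  agree-shift {i} {j} t L le agree r lt =
    trans (cong u (+-assoc i t r)) (trans (agree (t + r) (<-≤-trans (+-monoʳ-< t lt) le)) (cong u (sym (+-assoc j t r))))

  agree-join : ∀ {i j K L} t → t ≤ K → Agree i j K → Agree (i + t) (j + t) L → Agree i j (t + L)
  agree-join {i} {j} t t≤K agree₁ agree₂ r lt with r <? t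
  ... | yes r<t = agree₁ r (<-≤-trans r<t t≤K)
  ... | no r≮t = subst₂ (λ a b → u a ≡ u b) (cong (i +_) t+r′) (cong (j +_) t+r′)
                   (trans (cong u (sym (+-assoc i t r′))) (trans (agree₂ r′ r′<L) (cong u (+-assoc j t r′))))
    where
    r′ = r ∸ t
    t+r′ : t + r′ ≡ r
    t+r′ = m+[n∸m]≡n (≮⇒≥ r≮t)
    r′<L : r′ < _
    r′<L = +-cancelˡ-< t r′ _ (subst (_< t + _) (sym t+r′) lt)

  agree-cons : ∀ {i j K} → u i ≡ u j → Agree (suc i) (suc j) K → Agree i j (suc K)
  agree-cons {i} {j} head _ zero _ = trans (cong u (+-identityʳ i)) (trans head (cong u (sym (+-identityʳ j))))
  agree-cons {i} {j} _ tail (suc r) (s≤s lt) = trans (cong u (+-suc i r)) (trans (tail r lt) (cong u (sym (+-suc j r))))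

  PalindromeAt : ℕ → ℕ → Set
  PalindromeAt o L = ∀ a b → a + b + 1 ≡ L → u (o + a) ≡ u (o + b)

  occurs⇒palindromeAt : ∀ i w → OccursAt u i w → Palindrome w → PalindromeAt i (length w)
  occurs⇒palindromeAt i w occ pw a b eq =
    let a< , b< = <-from-sum a b eq in
    trans (occ a a<) (trans (palindrome-at w pw a b eq) (sym (occ b b<)))

  palindromeAt-extend : ∀ o L → u o ≡ u (suc o + L) → PalindromeAt (suc o) L → PalindromeAt o (suc (suc L))
  palindromeAt-extend o L ends pal zero b eq = begin
    u (o + 0)          ≡⟨ cong u (+-identityʳ o) ⟩
    u o                ≡⟨ ends ⟩
    u (suc o + L)      ≡⟨ cong u (+-suc o L) ⟨
    u (o + suc L)      ≡⟨ cong (λ t → u (o + t)) (suc-injective (trans (+-comm 1 b) eq)) ⟨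
    u (o + b)          ∎
    where open ≡-Reasoning
  palindromeAt-extend o L ends pal (suc a) zero eq =
    sym (palindromeAt-extend o L ends pal zero (suc a) (trans (cong (_+ 1) (sym (+-identityʳ (suc a)))) eq))
  palindromeAt-extend o L ends pal (suc a) (suc b) eq =
    trans (cong u (+-suc o a)) (trans (pal a b eq′) (cong u (sym (+-suc o b))))
    where
    eq′ : a + b + 1 ≡ L
    eq′ = suc-injective (suc-injective (trans (cong suc (cong (_+ 1) (sym (+-suc a b)))) eq))

  mirror-occurs : ∀ {i j L} → Mirror u i j L → ∀ c d w → Palindrome w → c + length w + d ≡ L →
                  OccursAt u (i + c) w → OccursAt u (j + d) w
  mirror-occurs {i} {j} mirror c d w pw eq occ t t< = begin
    u (j + d + t)       ≡⟨ cong u (+-assoc j d t) ⟩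
    u (j + (d + t))     ≡⟨ mirror (d + t) (c + s) (trans (arith d t c s) (trans (cong (λ x → c + x + d) t+s) eq)) ⟩
    u (i + (c + s))     ≡⟨ cong u (+-assoc i c s) ⟨
    u (i + c + s)       ≡⟨ occ s s< ⟩
    at w s              ≡⟨ palindrome-at w pw s t (trans (cong (_+ 1) (+-comm s t)) t+s) ⟩
    at w t              ∎
    where
    open ≡-Reasoning
    s = length w ∸ suc t
    t+s : t + s + 1 ≡ length w
    t+s = +-complement t<
    s< : s < length w
    s< = proj₂ (<-from-sum t s t+s)
    arith : ∀ d t c s → d + t + (c + s) + 1 ≡ c + (t + s + 1) + d
    arith = solve-∀

  module Windows (n : ℕ) where

    window : ℕ → Word
    window k = slice u k n

    length-window : ∀ k → length (window k) ≡ n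
    length-window k = length-slice u k n

    agree⇒window≡ : ∀ i j → Agree i j n → window i ≡ window j
    agree⇒window≡ i j agree = at-ext (window i) (window j) (trans (length-window i) (sym (length-window j)))
      λ t lt → let t<n = subst (t <_) (length-window j) lt in
        trans (at-slice u i n t t<n) (trans (agree t t<n) (sym (at-slice u j n t t<n)))

    window≡⇒agree : ∀ i j → window i ≡ window j → Agree i j n
    window≡⇒agree i j eq r lt = trans (sym (at-slice u i n r lt)) (trans (cong (λ v → at v r) eq) (at-slice u j n r lt))

    agree⇒window≡-shift : ∀ {i j K} t → t + n ≤ K → Agree i j K → window (i + t) ≡ window (j + t)
    agree⇒window≡-shift {i} {j} t le agree = agree⇒window≡ (i + t) (j + t) (agree-shift t n le agree)

    agree⇒window≡-within : ∀ {i j M} t → t ≤ M → Agree i j (n + M) → window (i + t) ≡ window (j + t)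
    agree⇒window≡-within t t≤M = agree⇒window≡-shift t (≤-trans (≤-reflexive (+-comm t n)) (+-monoʳ-≤ n t≤M))

    agree-window-next : ∀ i j → window i ≡ window j → u (i + n) ≡ u (j + n) → Agree i j (suc n)
    agree-window-next i j eq next r lt with m≤n⇒m<n∨m≡n (≤-pred lt)
    ... | inj₁ r<n = window≡⇒agree i j eq r r<n
    ... | inj₂ refl = next

    occurs-window-next : ∀ k → OccursAt u k (window k ++ [ u (k + n) ])
    occurs-window-next k = subst (λ t → OccursAt u k (window k ++ [ u (k + t) ])) (length-window k)
                             (occurs-++-next u k (window k) (occurs-slice u n k))

    factor-window : ∀ k → Factor u (window k)
    factor-window k = occurs⇒factor u k (window k) (occurs-slice u n k)

    factor-window-next : ∀ k → Factor u (window k ++ [ u (k + n) ])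
    factor-window-next k = occurs⇒factor u k _ (occurs-window-next k)

    factor-previous-window : ∀ k → Factor u (u k ∷ window (suc k))
    factor-previous-window k = occurs⇒factor u k _ (occurs-previous-∷ u k (window (suc k)) (occurs-slice u n (suc k)))

    factor-previous-window-next : ∀ k → Factor u (u k ∷ (window (suc k) ++ [ u (suc k + n) ]))
    factor-previous-window-next k = occurs⇒factor u k _ (occurs-previous-∷ u k _ (occurs-window-next (suc k)))

    agree-extendʳ : ∀ K i j → Agree i j n → (∀ t → t < K → UniqueRightExt u (window (i + t))) → Agree i j (n + K)
    agree-extendʳ zero i j agree _ = subst (Agree i j) (sym (+-identityʳ n)) agree
    agree-extendʳ (suc K) i j agree unique r lt with m≤n⇒m<n∨m≡n (≤-pred (subst (r <_) (+-suc n K) lt))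
    ... | inj₁ r<n+K = agreeK r r<n+K
      where agreeK = agree-extendʳ K i j agree (λ t lt → unique t (m≤n⇒m≤1+n lt))
    ... | inj₂ refl = trans (cong u (reassoc i)) (trans next (cong u (sym (reassoc j))))
      where
      agreeK = agree-extendʳ K i j agree (λ t lt → unique t (m≤n⇒m≤1+n lt))
      reassoc : ∀ i → i + (n + K) ≡ i + K + n
      reassoc i = trans (cong (i +_) (+-comm n K)) (sym (+-assoc i K n))
      same : window (i + K) ≡ window (j + K)
      same = agree⇒window≡-within K ≤-refl agreeK
      next : u (i + K + n) ≡ u (j + K + n)
      next = unique K (n<1+n K) _ _ (factor-window-next (i + K))
               (subst (λ v → Factor u (v ++ [ u (j + K + n) ])) (sym same) (factor-window-next (j + K)))

    agree-extendˡ : ∀ K i j → Agree (i + K) (j + K) n → (∀ t → t < K → UniqueLeftExt u (window (i + suc t))) →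
                    Agree i j (n + K)
    agree-extendˡ zero i j agree _ =
      subst₂ (λ a b → Agree a b (n + 0)) (+-identityʳ i) (+-identityʳ j) (subst (Agree (i + 0) (j + 0)) (sym (+-identityʳ n)) agree)
    agree-extendˡ (suc K) i j agree unique = subst (Agree i j) (sym (+-suc n K)) (agree-cons previous agreeK)
      where
      agreeK : Agree (suc i) (suc j) (n + K)
      agreeK = agree-extendˡ K (suc i) (suc j) (subst₂ (λ a b → Agree a b n) (+-suc i K) (+-suc j K) agree)
                 (λ t lt → subst (UniqueLeftExt u ∘ window) (+-suc i (suc t)) (unique (suc t) (s≤s lt)))
      same : window (suc i) ≡ window (suc j)
      same = agree⇒window≡ (suc i) (suc j) (agree-≤ (m≤m+n n K) agreeK)
      previous : u i ≡ u j
      previous = subst (UniqueLeftExt u ∘ window) (trans (+-suc i 0) (cong suc (+-identityʳ i))) (unique 0 (s≤s z≤n)) _ _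
                   (factor-previous-window i) (subst (λ v → Factor u (u j ∷ v)) (sym same) (factor-previous-window j))

    occurs⇒window≡ : ∀ k w → length w ≡ n → OccursAt u k w → window k ≡ w
    occurs⇒window≡ k w refl occ = occurs⇒slice u k w occ

    palindromeAt-window-reverse : ∀ o L a b → PalindromeAt o L → a + b + n ≡ L →
                                  reverse (window (o + a)) ≡ window (o + b)
    palindromeAt-window-reverse o L a b pal eq =
      at-ext _ _ (trans (length-reverse (window (o + a))) (trans (length-window _) (sym (length-window _)))) pointwise
      where
      pointwise : ∀ x → x < length (window (o + b)) → at (reverse (window (o + a))) x ≡ at (window (o + b)) x
      pointwise x x<∣w∣ = begin
        at (reverse (window (o + a))) x ≡⟨ at-reverse (window (o + a)) x y (trans x+y (sym (length-window _))) ⟩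
        at (window (o + a)) y           ≡⟨ at-slice u (o + a) n y y<n ⟩
        u (o + a + y)                   ≡⟨ cong u (+-assoc o a y) ⟩
        u (o + (a + y))                 ≡⟨ pal (a + y) (b + x) (trans (arith a y b x) (trans (cong (a + b +_) x+y) eq)) ⟩
        u (o + (b + x))                 ≡⟨ cong u (+-assoc o b x) ⟨
        u (o + b + x)                   ≡⟨ at-slice u (o + b) n x x<n ⟨
        at (window (o + b)) x           ∎
        where
        open ≡-Reasoning
        x<n : x < n
        x<n = subst (x <_) (length-window _) x<∣w∣
        y = n ∸ suc x
        x+y : x + y + 1 ≡ n
        x+y = +-complement x<n
        y<n : y < n
        y<n = proj₂ (<-from-sum x y x+y)
        arith : ∀ a y b x → a + y + (b + x) + 1 ≡ a + b + (x + y + 1)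
        arith = solve-∀

-- Palindromic return paths

OtherPalindrome : InfWord → ℕ → Word → Word → Word → Set
OtherPalindrome u n z₁ z₂ w = Factor u w × Palindrome w × ((length w ≡ n × w ≢ z₁ × w ≢ z₂) ⊎ length w ≡ suc n)

two-other-palindromes : ∀ u n z₁ z₂ A B → PalCount u n A → PalCount u (suc n) B → A + B ≡ 4 →
                        ∃[ w₁ ] ∃[ w₂ ] w₁ ≢ w₂ × OtherPalindrome u n z₁ z₂ w₁ × OtherPalindrome u n z₁ z₂ w₂
two-other-palindromes u n z₁ z₂ A B count-n count-n+1 A+B≡4 =
  let w₁ , w₁∈ , w₁∉ = ∃-∈-∉ _≟ʷ_ (X.elems ++ Y.elems) known all-unique (k<total 2 (s≤s (s≤s (s≤s z≤n))))
      w₂ , w₂∈ , w₂∉ = ∃-∈-∉ _≟ʷ_ (X.elems ++ Y.elems) (w₁ ∷ known) all-unique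
                              (k<total 3 (s≤s (s≤s (s≤s (s≤s z≤n)))))
  in w₁ , w₂ , (λ w₁≡w₂ → w₂∉ (here (sym w₁≡w₂))) , other w₁ w₁∈ w₁∉ , other w₂ w₂∈ (w₂∉ ∘ there)
  where
  module X = Listing (listing count-n)
  module Y = Listing (listing count-n+1)
  known = z₁ ∷ z₂ ∷ []
  all-unique : Unique (X.elems ++ Y.elems)
  all-unique = ++⁺ X.unique Y.unique λ (v∈X , v∈Y) →
    1+n≢n (sym (trans (sym (proj₁ (X.sound _ v∈X))) (proj₁ (Y.sound _ v∈Y))))
  k<total : ∀ k → k < 4 → k < length (X.elems ++ Y.elems)
  k<total k k<4 = subst (k <_) (sym (trans (length-++ X.elems) (trans (cong₂ _+_ X.length≡ Y.length≡) A+B≡4))) k<4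
  other : ∀ w → w ∈ X.elems ++ Y.elems → w ∉ known → OtherPalindrome u n z₁ z₂ w
  other w w∈ w∉ with ∈-++⁻ X.elems w∈
  ... | inj₁ w∈X = let ∣w∣ , fw , pw = X.sound w w∈X in fw , pw , inj₁ (∣w∣ , w∉ ∘ here , w∉ ∘ there ∘ here)
  ... | inj₂ w∈Y = let ∣w∣ , fw , pw = Y.sound w w∈Y in fw , pw , inj₂ ∣w∣

module TwoSpecialPalindromes
  (u : InfWord) (closed : ClosedUnderReversal u) (n : ℕ) (z₁ z₂ : Word)
  (∣z₁∣ : length z₁ ≡ n) (fz₁ : Factor u z₁) (pz₁ : Palindrome z₁) (pz₂ : Palindrome z₂) (z₁≢z₂ : z₁ ≢ z₂)
  (avoiding⇒uniqueLeftExt : ∀ v → length v ≡ n → Factor u v → v ≢ z₁ → v ≢ z₂ → UniqueLeftExt u v) where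

  open Windows u n

  Avoids : Word → Set
  Avoids v = v ≢ z₁ × v ≢ z₂

  Special : ℕ → Set
  Special k = window k ≡ z₁ ⊎ window k ≡ z₂

  Ordinary : ℕ → Set
  Ordinary k = Avoids (window k)

  special? : ∀ k → Dec (Special k)
  special? k = (window k ≟ʷ z₁) ⊎-dec (window k ≟ʷ z₂)

  ¬special⇒ordinary : ∀ {k} → ¬ Special k → Ordinary k
  ¬special⇒ordinary ¬special = ¬special ∘ inj₁ , ¬special ∘ inj₂

  special⇒palindrome : ∀ {k} → Special k → Palindrome (window k)
  special⇒palindrome (inj₁ refl) = pz₁
  special⇒palindrome (inj₂ refl) = pz₂

  avoids-reverse : ∀ {v v′} → reverse v ≡ v′ → Avoids v → Avoids v′
  avoids-reverse {v} refl (v≢z₁ , v≢z₂) =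
    (λ eq → v≢z₁ (trans (sym (reverse-involutive v)) (trans (cong reverse eq) pz₁))) ,
    (λ eq → v≢z₂ (trans (sym (reverse-involutive v)) (trans (cong reverse eq) pz₂)))

  ordinary-resp : ∀ {j k} → window j ≡ window k → Ordinary k → Ordinary j
  ordinary-resp eq = subst Avoids (sym eq)

  ordinary⇒uniqueLeftExt : ∀ k → Ordinary k → UniqueLeftExt u (window k)
  ordinary⇒uniqueLeftExt k (≢z₁ , ≢z₂) = avoiding⇒uniqueLeftExt (window k) (length-window k) (factor-window k) ≢z₁ ≢z₂

  avoiding⇒uniqueRightExt : ∀ v → length v ≡ n → Factor u v → Avoids v → UniqueRightExt u v
  avoiding⇒uniqueRightExt v ∣v∣ fv avoids x y fx fy =
    avoiding⇒uniqueLeftExt (reverse v) (trans (length-reverse v) ∣v∣) (closed v fv) ≢z₁ ≢z₂ x y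
      (subst (Factor u) (reverse-++-[] v x) (closed _ fx)) (subst (Factor u) (reverse-++-[] v y) (closed _ fy))
    where
    ≢z₁ = proj₁ (avoids-reverse refl avoids)
    ≢z₂ = proj₂ (avoids-reverse refl avoids)

  ordinary⇒uniqueRightExt : ∀ k → Ordinary k → UniqueRightExt u (window k)
  ordinary⇒uniqueRightExt k = avoiding⇒uniqueRightExt (window k) (length-window k) (factor-window k)

  -- The letters around a palindrome whose first window is ordinary agree: the last window is the
  -- reversal of the first one, hence has a unique right extension, and reversal closure shows that
  -- the letter before the palindrome is such an extension.
  palindromeAt-grow : ∀ o L → n ≤ L → PalindromeAt u (suc o) L → Ordinary (suc o) → PalindromeAt u o (suc (suc L))
  palindromeAt-grow o L n≤L pal ordinary = palindromeAt-extend u o L (sym exit≡entry) pal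
    where
    q = L ∸ n
    v = window (suc o + q)
    first⇒last : reverse (window (suc o)) ≡ v
    first⇒last = subst (λ x → reverse (window x) ≡ v) (+-identityʳ (suc o))
                   (palindromeAt-window-reverse (suc o) L 0 q pal (m∸n+n≡m n≤L))
    entry : Factor u (v ++ [ u o ])
    entry = subst (Factor u) (trans (unfold-reverse (u o) (window (suc o))) (cong (_++ [ u o ]) first⇒last))
              (closed _ (factor-previous-window o))
    exit : Factor u (v ++ [ u (suc o + L) ])
    exit = subst (λ x → Factor u (v ++ [ u x ])) (trans (+-assoc (suc o) q n) (cong (suc o +_) (m∸n+n≡m n≤L)))
             (factor-window-next (suc o + q))
    exit≡entry : u (suc o + L) ≡ u o
    exit≡entry = avoiding⇒uniqueRightExt v (length-window _) (factor-window _) (avoids-reverse first⇒last ordinary) _ _ exit entry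

  -- A palindromic return path centred at w₀: u[start, start + n + period) is a palindrome that
  -- begins and ends with the same special window and meets only ordinary windows in between.
  record Loop (w₀ : Word) : Set where
    field
      start period offset : ℕ
      period≥1 : 1 ≤ period
      special-start : Special start
      returns : window (start + period) ≡ window start
      ordinary-inside : ∀ r → 0 < r → r < period → Ordinary (start + r)
      palindrome : PalindromeAt u start (n + period)
      centred : n + period ≡ length w₀ + (offset + offset)
      occurs-centre : OccursAt u (start + offset) w₀

  excess : ∀ w₀ → OtherPalindrome u n z₁ z₂ w₀ → ∃[ δ ] δ ≤ 1 × length w₀ ≡ n + δ × (δ ≡ 0 → Avoids w₀)
  excess w₀ (_ , _ , inj₁ (∣w₀∣ , avoids)) = 0 , z≤n , trans ∣w₀∣ (sym (+-identityʳ n)) , λ _ → avoids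
  excess w₀ (_ , _ , inj₂ ∣w₀∣) = 1 , s≤s z≤n , trans ∣w₀∣ (+-comm 1 n) , λ ()

  -- If w₀ only occurs before the first z₁, reverse the prefix of u ending with that z₁.
  occurrence-after-special : ∀ w₀ → Palindrome w₀ → length w₀ ≤ suc n →
                             Factor u w₀ → ∃[ i ] OccursAt u i w₀ × ∃[ e ] e ≤ i × Special e
  occurrence-after-special w₀ pw₀ ∣w₀∣≤ fw₀ with factor⇒occurs u w₀ fw₀ | factor⇒occurs u z₁ fz₁
  ... | i , occ | f , occ-z₁ with f ≤? i
  ... | yes f≤i = i , occ , f , f≤i , inj₁ (occurs⇒window≡ f z₁ ∣z₁∣ occ-z₁)
  ... | no f≰i = j + d , mirror-occurs u mirror i d w₀ pw₀ i+∣w₀∣+d occ ,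
                 j , m≤m+n j d ,
                 inj₁ (occurs⇒window≡ j z₁ ∣z₁∣ (subst (λ x → OccursAt u x z₁) (+-identityʳ j) z₁-mirrored))
    where
    j = proj₁ (reversed-slice u closed 0 (f + n))
    mirror : Mirror u 0 j (f + n)
    mirror = proj₂ (reversed-slice u closed 0 (f + n))
    ends-before : i + length w₀ ≤ f + n
    ends-before = ≤-trans (+-monoʳ-≤ i ∣w₀∣≤) (≤-trans (≤-reflexive (+-suc i n)) (+-monoˡ-≤ n (≰⇒> f≰i)))
    d = f + n ∸ (i + length w₀)
    i+∣w₀∣+d : i + length w₀ + d ≡ f + n
    i+∣w₀∣+d = m+[n∸m]≡n ends-before
    z₁-mirrored : OccursAt u (j + 0) z₁
    z₁-mirrored = mirror-occurs u mirror f 0 z₁ pz₁ (trans (+-identityʳ _) (cong (f +_) ∣z₁∣)) occ-z₁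

  OrdinaryBetween : ℕ → ℕ → Set
  OrdinaryBetween e i = ∀ t → e < t → t ≤ i → Ordinary t

  palindromeAt-grow-across : ∀ e k L → n ≤ L → PalindromeAt u (e + k) L → OrdinaryBetween e (e + k) →
                             PalindromeAt u e (L + (k + k))
  palindromeAt-grow-across e zero L _ pal _ = subst₂ (PalindromeAt u) (+-identityʳ e) (sym (+-identityʳ L)) pal
  palindromeAt-grow-across e (suc k) L n≤L pal ordinary =
    subst (PalindromeAt u e) (arith L k)
      (palindromeAt-grow e (L + (k + k)) (≤-trans n≤L (m≤m+n L _)) grown (ordinary (suc e) (n<1+n e) e+1≤))
    where
    arith : ∀ L k → suc (suc (L + (k + k))) ≡ L + (suc k + suc k)
    arith = solve-∀
    e+1≤ : suc e ≤ e + suc k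
    e+1≤ = subst (suc e ≤_) (sym (+-suc e k)) (s≤s (m≤m+n e k))
    grown : PalindromeAt u (suc e) (L + (k + k))
    grown = palindromeAt-grow-across (suc e) k L n≤L (subst (λ x → PalindromeAt u x L) (+-suc e k) pal)
              (λ t e+1<t t≤ → ordinary t (<-trans (n<1+n e) e+1<t) (subst (t ≤_) (sym (+-suc e k)) t≤))

  -- Windows in the second half of the palindrome mirror windows of the first half.
  ordinary-inside-palindrome : ∀ e k δ → δ ≤ 1 → PalindromeAt u e (n + (δ + (k + k))) → OrdinaryBetween e (e + k) →
                    ∀ r → 0 < r → r < δ + (k + k) → Ordinary (e + r)
  ordinary-inside-palindrome e k δ δ≤1 pal ordinary r 0<r r<M with r ≤? k
  ... | yes r≤k = ordinary (e + r) (subst (_< e + r) (+-identityʳ e) (+-monoʳ-< e 0<r)) (+-monoʳ-≤ e r≤k)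
  ... | no r≰k = avoids-reverse mirrored
                   (ordinary (e + m) (subst (_< e + m) (+-identityʳ e) (+-monoʳ-< e 0<m)) (+-monoʳ-≤ e m≤k))
    where
    M = δ + (k + k)
    m = M ∸ r
    r+m : r + m ≡ M
    r+m = m+[n∸m]≡n (<⇒≤ r<M)
    m≤k : m ≤ k
    m≤k = +-cancelˡ-≤ (suc k) m k (≤-trans (+-monoˡ-≤ m (≰⇒> r≰k))
            (≤-trans (≤-reflexive r+m) (+-monoˡ-≤ (k + k) δ≤1)))
    0<m : 0 < m
    0<m with m | r+m
    ... | zero | r+0≡M = ⊥-elim (<-irrefl (trans (sym (+-identityʳ r)) r+0≡M) r<M)
    ... | suc _ | _ = s≤s z≤n
    mirrored : reverse (window (e + m)) ≡ window (e + r)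
    mirrored = palindromeAt-window-reverse e (n + M) m r pal
                 (trans (cong (_+ n) (+-comm m r)) (trans (cong (_+ n) r+m) (+-comm M n)))

  -- A zero period would make w₀ itself the special window at e.
  loop-period-positive : ∀ w₀ δ k e i → length w₀ ≡ n + δ → (δ ≡ 0 → Avoids w₀) → OccursAt u i w₀ →
                         e + k ≡ i → Special e → 1 ≤ δ + (k + k)
  loop-period-positive _ (suc _) _ _ _ _ _ _ _ _ = s≤s z≤n
  loop-period-positive _ zero (suc _) _ _ _ _ _ _ _ = s≤s z≤n
  loop-period-positive w₀ zero zero e i ∣w₀∣ avoids occ e+0≡i special-e = ⊥-elim $
    [ proj₁ (avoids refl) ∘ trans (sym i≡w₀) , proj₂ (avoids refl) ∘ trans (sym i≡w₀) ]′
      (subst Special (trans (sym (+-identityʳ e)) e+0≡i) special-e)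
    where
    i≡w₀ : window i ≡ w₀
    i≡w₀ = occurs⇒window≡ i w₀ (trans ∣w₀∣ (+-identityʳ n)) occ

  loop : ∀ w₀ → OtherPalindrome u n z₁ z₂ w₀ → Loop w₀
  loop w₀ other@(fw₀ , pw₀ , _) with excess w₀ other
  ... | δ , δ≤1 , ∣w₀∣ , δ≡0⇒avoids
    with occurrence-after-special w₀ pw₀ (subst₂ _≤_ (sym ∣w₀∣) (+-comm n 1) (+-monoʳ-≤ n δ≤1)) fw₀
  ... | i , occ , e₀ , e₀≤i , special-e₀ with greatest Special special? e₀ i special-e₀ e₀≤i
  ... | e , _ , e≤i , special-e , none-after = record
    { start = e ; period = M ; offset = k ; period≥1 = loop-period-positive w₀ δ k e i ∣w₀∣ δ≡0⇒avoids occ e+k special-e ; special-start = special-e ; returns = returns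
    ; ordinary-inside = ordinary-inside-palindrome e k δ δ≤1 pal ordinary ; palindrome = pal ; centred = centred
    ; occurs-centre = subst (λ x → OccursAt u x w₀) (sym e+k) occ }
    where
    k = i ∸ e
    e+k : e + k ≡ i
    e+k = m+[n∸m]≡n e≤i
    M = δ + (k + k)
    centred : n + M ≡ length w₀ + (k + k)
    centred = trans (sym (+-assoc n δ (k + k))) (cong (_+ (k + k)) (sym ∣w₀∣))
    ordinary : OrdinaryBetween e (e + k)
    ordinary t e<t t≤ = ¬special⇒ordinary (none-after t e<t (subst (t ≤_) e+k t≤))
    pal : PalindromeAt u e (n + M)
    pal = subst (PalindromeAt u e) (sym centred)
            (palindromeAt-grow-across e k (length w₀) (subst (n ≤_) (sym ∣w₀∣) (m≤m+n n δ))
              (subst (λ x → PalindromeAt u x (length w₀)) (sym e+k) (occurs⇒palindromeAt u i w₀ occ pw₀)) ordinary)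
    returns : window (e + M) ≡ window e
    returns = trans (sym (palindromeAt-window-reverse e (n + M) 0 M pal (+-comm M n)))
                    (trans (cong (reverse ∘ window) (+-identityʳ e)) (special⇒palindrome special-e))

  agree-backward : ∀ a b K → Agree u (a + K) (b + K) (suc n) → (∀ t → t < K → Ordinary (a + suc t)) → Agree u a b (K + suc n)
  agree-backward a b K agree ordinary =
    agree-join u K (m≤n+m K n)
      (agree-extendˡ K a b (agree-≤ u (n≤1+n n) agree) (λ t t<K → ordinary⇒uniqueLeftExt _ (ordinary t t<K)))
      agree

  module _ {w₀ : Word} (ℓ : Loop w₀) where
    open Loop ℓ

    period′ : ℕ
    period′ = period ∸ 1

    suc-period′ : suc period′ ≡ period
    suc-period′ = m+[n∸m]≡n period≥1

    ordinary-after-start : ∀ t → t < period′ → Ordinary (start + suc t)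
    ordinary-after-start t t< = ordinary-inside (suc t) (s≤s z≤n) (subst (suc t <_) suc-period′ (s≤s t<))

    entry≡exit : u (start + period′) ≡ u (start + n)
    entry≡exit = palindrome period′ n (trans (+-comm (period′ + n) 1) (trans (cong (_+ n) suc-period′) (+-comm period n)))

    -- Ordinary windows have a unique right extension, so the path after a start window is forced.
    loop-forward : ∀ m → window m ≡ window start → u (m + n) ≡ u (start + n) → Agree u m start (n + period)
    loop-forward m same-window same-exit =
      agree-sym u (subst (Agree u start m) (trans (sym (+-suc n period′)) (cong (n +_) suc-period′))
        (agree-cons u (trans (cong u (sym (+-identityʳ start))) (trans (first 0 (s≤s z≤n)) (cong u (+-identityʳ m)))) rest))
      where
      first : Agree u start m (suc n)
      first = agree-window-next start m (sym same-window) (sym same-exit)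
      rest : Agree u (suc start) (suc m) (n + period′)
      rest = agree-extendʳ period′ (suc start) (suc m)
               (λ r r<n → trans (cong u (sym (+-suc start r))) (trans (first (suc r) (s≤s r<n)) (cong u (+-suc m r))))
               (λ t t< → subst (UniqueRightExt u ∘ window) (+-suc start t) (ordinary⇒uniqueRightExt _ (ordinary-after-start t t<)))

    entering : ∀ q → u q ≡ u (start + period′) → window (suc q) ≡ window (start + period) →
               Agree u (start + period′) q (suc n)
    entering q same-entry same-window = agree-sym u $
      agree-cons u same-entry (subst (λ x → Agree u (suc q) x n) (trans (cong (start +_) (sym suc-period′)) (+-suc start period′))
                                (window≡⇒agree (suc q) (start + period) same-window))

    -- Backwards the path is forced likewise, unless it would have to begin before position 0.
    loop-backward : ∀ q → u q ≡ u (start + period′) → window (suc q) ≡ window (start + period) →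
                    (∃[ q′ ] q′ + period′ ≡ q × window q′ ≡ window start × u (q′ + n) ≡ u (start + n))
                    ⊎ (∀ t → t ≤ q → Ordinary t)
    loop-backward q same-entry same-window with period′ ≤? q
    ... | yes period′≤q =
      inj₁ (q′ , q′+period′ , agree⇒window≡ q′ start (agree-≤ u (≤-trans (n≤1+n n) (m≤n+m (suc n) period′)) agree′) ,
            agree′ n (<-≤-trans (n<1+n n) (m≤n+m (suc n) period′)))
      where
      q′ = q ∸ period′
      q′+period′ : q′ + period′ ≡ q
      q′+period′ = trans (+-comm q′ period′) (m+[n∸m]≡n period′≤q)
      agree′ : Agree u q′ start (period′ + suc n)
      agree′ = agree-sym u (agree-backward start q′ period′
                 (subst (λ x → Agree u (start + period′) x (suc n)) (sym q′+period′) (entering q same-entry same-window))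
                 ordinary-after-start)
    ... | no period′≰q = inj₂ λ t t≤q →
      ordinary-resp (sym (agree⇒window≡-shift t (+-mono-≤ t≤q (n≤1+n n)) agree′)) (ordinary-shifted t t≤q)
      where
      d = period′ ∸ q
      d+q : d + q ≡ period′
      d+q = trans (+-comm d q) (m+[n∸m]≡n (<⇒≤ (≰⇒> period′≰q)))
      0<d : 0 < d
      0<d with d | d+q
      ... | zero | q≡period′ = ⊥-elim (period′≰q (≤-reflexive (sym q≡period′)))
      ... | suc _ | _ = s≤s z≤n
      ordinary-shifted : ∀ t → t ≤ q → Ordinary (start + d + t)
      ordinary-shifted t t≤q = subst Ordinary (sym (+-assoc start d t))
        (ordinary-inside (d + t) (<-≤-trans 0<d (m≤m+n d t))
           (subst (d + t <_) suc-period′ (s≤s (subst (d + t ≤_) d+q (+-monoʳ-≤ d t≤q)))))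
      agree′ : Agree u (start + d) 0 (q + suc n)
      agree′ = agree-backward (start + d) 0 q
                 (subst (λ x → Agree u x q (suc n)) (trans (cong (start +_) (sym d+q)) (sym (+-assoc start d q)))
                   (entering q same-entry same-window))
                 (λ t t<q → ordinary-shifted (suc t) t<q)

    loop-after : ∀ m → window m ≡ window start → u (m + n) ≡ u (start + n) →
                 window (m + period) ≡ window start × u (m + period′) ≡ u (start + period′) ×
                 (∀ k → m < k → k < m + period → Ordinary k)
    loop-after m same-window same-exit =
      trans (agree⇒window≡-within period ≤-refl agree) returns ,
      agree period′ (<-≤-trans (subst (period′ <_) suc-period′ (n<1+n period′)) (m≤n+m period n)) ,
      inside
      where
      agree = loop-forward m same-window same-exit
      inside : ∀ k → m < k → k < m + period → Ordinary k
      inside k m<k k<m+M = ordinary-resp (trans (cong window (sym m+t)) (agree⇒window≡-within t (<⇒≤ t<M) agree))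
                             (ordinary-inside t 0<t t<M)
        where
        t = k ∸ m
        m+t : m + t ≡ k
        m+t = m+[n∸m]≡n (<⇒≤ m<k)
        0<t : 0 < t
        0<t = +-cancelˡ-< m 0 t (subst₂ _<_ (sym (+-identityʳ m)) (sym m+t) m<k)
        t<M : t < period
        t<M = +-cancelˡ-< m t period (subst (_< m + period) (sym m+t) k<m+M)

  LeavesBy : Word → Letter → ℕ → Set
  LeavesBy z y m = window m ≡ z × u (m + n) ≡ y

  leavesBy? : ∀ z y m → Dec (LeavesBy z y m)
  leavesBy? z y m = (window m ≟ʷ z) ×-dec (u (m + n) ≟ᶠ y)

  factor⇒window : ∀ z → length z ≡ n → Factor u z → ∃[ k ] window k ≡ z
  factor⇒window z ∣z∣ fz = let k , occ = factor⇒occurs u z fz in k , occurs⇒window≡ k z ∣z∣ occ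

  module _ (z₁-palindromic : ∀ x y → Factor u (x ∷ (z₁ ++ [ y ])) → x ≡ y) where

    entry≡exit-z₁ : ∀ q → window (suc q) ≡ z₁ → u q ≡ u (suc q + n)
    entry≡exit-z₁ q window≡z₁ = z₁-palindromic _ _
      (subst (λ v → Factor u (u q ∷ (v ++ [ u (suc q + n) ]))) window≡z₁ (factor-previous-window-next q))

    module _ {w₀} (ℓ : Loop w₀) (start≡z₁ : window (Loop.start ℓ) ≡ z₁) where
      open Loop ℓ

      -- Following the loop from a z₁ left by its exit letter returns to z₁, entering and hence
      -- leaving it by that letter again.
      z₁-leaves-by-exit-after : ∀ i → LeavesBy z₁ (u (start + n)) i →
                                ∀ k → i ≤ k → window k ≡ z₁ → u (k + n) ≡ u (start + n)
      z₁-leaves-by-exit-after i leaves-i k i≤k k≡z₁ with greatest (LeavesBy z₁ _) (leavesBy? z₁ _) i k leaves-i i≤k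
      ... | m , _ , m≤k , (m≡z₁ , exit-m) , none-after with m≤n⇒m<n∨m≡n m≤k
      ... | inj₂ refl = exit-m
      ... | inj₁ m<k with loop-after ℓ m (trans m≡z₁ (sym start≡z₁)) exit-m | k <? m + period
      ... | _ , _ , inside | yes k<m+M = ⊥-elim (proj₁ (inside k m<k k<m+M) k≡z₁)
      ... | returns′ , same-entry , _ | no k≮m+M =
        ⊥-elim (none-after (m + period) (m<m+n m period≥1) (≮⇒≥ k≮m+M) (m+M≡z₁ , leaves))
        where
        m+M≡z₁ : window (m + period) ≡ z₁
        m+M≡z₁ = trans returns′ start≡z₁
        m+M = trans (sym (+-suc m (period′ ℓ))) (cong (m +_) (suc-period′ ℓ))
        leaves : u (m + period + n) ≡ u (start + n)
        leaves = trans (sym (subst (λ x → u (m + period′ ℓ) ≡ u (x + n)) m+M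
                          (entry≡exit-z₁ (m + period′ ℓ) (subst (λ x → window x ≡ z₁) (sym m+M) m+M≡z₁))))
                       (trans same-entry (entry≡exit ℓ))

      z₁-absent-before-first-exit : ∀ i → LeavesBy z₁ (u (start + n)) i → (∀ j → j < i → ¬ LeavesBy z₁ (u (start + n)) j) →
                                    ∀ k → k < i → window k ≢ z₁
      z₁-absent-before-first-exit (suc q) (i≡z₁ , exit-i) minimal k k<i
        with loop-backward ℓ q (trans (entry≡exit-z₁ q i≡z₁) (trans exit-i (sym (entry≡exit ℓ))))
                             (trans i≡z₁ (trans (sym start≡z₁) (sym returns)))
      ... | inj₁ (q′ , q′+M′ , q′≡start , exit-q′) =
        ⊥-elim (minimal q′ (s≤s (subst (q′ ≤_) q′+M′ (m≤m+n q′ _))) (trans q′≡start start≡z₁ , exit-q′))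
      ... | inj₂ ordinary = proj₁ (ordinary k (≤-pred k<i))

    -- Hence every z₁ would leave by the exit letter of the loop.
    no-loop-at-z₁ : ∀ (r₁ r₂ : Letter) → r₁ ≢ r₂ → Factor u (z₁ ++ [ r₁ ]) → Factor u (z₁ ++ [ r₂ ]) →
                    ∀ {w₀} (ℓ : Loop w₀) → window (Loop.start ℓ) ≢ z₁
    no-loop-at-z₁ r₁ r₂ r₁≢r₂ fr₁ fr₂ ℓ start≡z₁
      with least (LeavesBy z₁ y) (leavesBy? z₁ y) (Loop.start ℓ) (start≡z₁ , refl) | other-exit
      where
      y = u (Loop.start ℓ + n)
      other-exit : ∃[ y′ ] y′ ≢ y × Factor u (z₁ ++ [ y′ ])
      other-exit with r₁ ≟ᶠ y
      ... | yes r₁≡y = r₂ , (λ r₂≡y → r₁≢r₂ (trans r₁≡y (sym r₂≡y))) , fr₂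
      ... | no r₁≢y = r₁ , r₁≢y , fr₁
    ... | i , leaves-i , _ , minimal | y′ , y′≢y , fy′ with factor⇒occurs u _ fy′
    ... | j , occ with j <? i
    ... | yes j<i = z₁-absent-before-first-exit ℓ start≡z₁ i leaves-i minimal j j<i j≡z₁
      where j≡z₁ = occurs⇒window≡ j z₁ ∣z₁∣ (occurs-init u j z₁ y′ occ)
    ... | no j≮i = y′≢y (trans (sym (subst (λ x → u (j + x) ≡ y′) ∣z₁∣ (occurs-last u j z₁ y′ occ)))
                              (z₁-leaves-by-exit-after ℓ start≡z₁ i leaves-i j (≮⇒≥ j≮i) j≡z₁))
      where j≡z₁ = occurs⇒window≡ j z₁ ∣z₁∣ (occurs-init u j z₁ y′ occ)

  z₁-absent-until-next-z₂ : ∀ {w} (ℓ : Loop w) → window (Loop.start ℓ) ≡ z₂ →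
                            ∀ m k → m ≤ k → window m ≡ z₂ → (∀ j → m < j → j ≤ k → window j ≢ z₂) →
                            u (m + n) ≡ u (Loop.start ℓ + n) → window k ≢ z₁
  z₁-absent-until-next-z₂ ℓ start≡z₂ m k m≤k m≡z₂ none-after same-exit k≡z₁ with m≤n⇒m<n∨m≡n m≤k
  ... | inj₂ refl = z₁≢z₂ (trans (sym k≡z₁) m≡z₂)
  ... | inj₁ m<k with loop-after ℓ m (trans m≡z₂ (sym start≡z₂)) same-exit | k <? m + Loop.period ℓ
  ... | _ , _ , inside | yes k<m+M = proj₁ (inside k m<k k<m+M) k≡z₁
  ... | returns′ , _ , _ | no k≮m+M =
    none-after (m + Loop.period ℓ) (m<m+n m (Loop.period≥1 ℓ)) (≮⇒≥ k≮m+M) (trans returns′ start≡z₂)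

  z₁-absent-before-first-z₂ : ∀ {w} (ℓ : Loop w) → window (Loop.start ℓ) ≡ z₂ →
                              ∀ q → window (suc q) ≡ z₂ → (∀ j → j < suc q → window j ≢ z₂) →
                              u q ≡ u (Loop.start ℓ + n) → ∀ k → k ≤ q → window k ≢ z₁
  z₁-absent-before-first-z₂ ℓ start≡z₂ q q+1≡z₂ minimal same-entry k k≤q
    with loop-backward ℓ q (trans same-entry (sym (entry≡exit ℓ)))
                         (trans q+1≡z₂ (trans (sym start≡z₂) (sym (Loop.returns ℓ))))
  ... | inj₁ (q′ , q′+M′ , q′≡start , _) =
    ⊥-elim (minimal q′ (s≤s (subst (q′ ≤_) q′+M′ (m≤m+n q′ _))) (trans q′≡start start≡z₂))
  ... | inj₂ ordinary = proj₁ (ordinary k k≤q)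

  -- If loops leave z₂ by two different letters, every z₂ is left and entered along a loop, so
  -- walking forwards from the first z₂, and backwards before it, meets only z₂ and ordinary windows.
  no-loops-by-both-exits : ∀ e₁ e₂ → LeftExtIn u z₂ e₁ e₂ → ∀ {wa wb} (ℓa : Loop wa) (ℓb : Loop wb) →
                           window (Loop.start ℓa) ≡ z₂ → window (Loop.start ℓb) ≡ z₂ →
                           u (Loop.start ℓa + n) ≢ u (Loop.start ℓb + n) → ⊥
  no-loops-by-both-exits e₁ e₂ within ℓa ℓb a≡z₂ b≡z₂ ya≢yb = z₁-absent (factor⇒window z₁ ∣z₁∣ fz₁)
    where
    ya = u (Loop.start ℓa + n)
    yb = u (Loop.start ℓb + n)
    ext-of-z₂ : ∀ y → Factor u (z₂ ++ [ y ]) → y ≡ e₁ ⊎ y ≡ e₂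
    ext-of-z₂ y f = within y (palindrome-rightExt⇒leftExt u closed y z₂ pz₂ f)
    exiting-z₂ : ∀ m → window m ≡ z₂ → Factor u (z₂ ++ [ u (m + n) ])
    exiting-z₂ m m≡z₂ = subst (λ v → Factor u (v ++ [ u (m + n) ])) m≡z₂ (factor-window-next m)
    one-of-the-exits : ∀ y → y ≡ e₁ ⊎ y ≡ e₂ → y ≡ ya ⊎ y ≡ yb
    one-of-the-exits y = pair-exhausted ya≢yb (ext-of-z₂ ya (exiting-z₂ _ a≡z₂)) (ext-of-z₂ yb (exiting-z₂ _ b≡z₂))

    first = least (λ m → window m ≡ z₂) (λ m → window m ≟ʷ z₂) _ a≡z₂
    i₁ = proj₁ first
    i₁≡z₂ = proj₁ (proj₂ first)
    none-before-i₁ = proj₂ (proj₂ (proj₂ first))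

    after : ∀ k → i₁ ≤ k → window k ≢ z₁
    after k i₁≤k with greatest (λ m → window m ≡ z₂) (λ m → window m ≟ʷ z₂) i₁ k i₁≡z₂ i₁≤k
    ... | m , _ , m≤k , m≡z₂ , none-after with one-of-the-exits _ (ext-of-z₂ _ (exiting-z₂ m m≡z₂))
    ... | inj₁ exit-a = z₁-absent-until-next-z₂ ℓa a≡z₂ m k m≤k m≡z₂ none-after exit-a
    ... | inj₂ exit-b = z₁-absent-until-next-z₂ ℓb b≡z₂ m k m≤k m≡z₂ none-after exit-b

    before : ∀ k → k < i₁ → window k ≢ z₁
    before k k<i₁ with i₁ | i₁≡z₂ | none-before-i₁
    ... | suc q | q+1≡z₂ | minimal
      with one-of-the-exits (u q) (within (u q) (subst (λ v → Factor u (u q ∷ v)) q+1≡z₂ (factor-previous-window q)))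
    ... | inj₁ entry-a = z₁-absent-before-first-z₂ ℓa a≡z₂ q q+1≡z₂ minimal entry-a k (≤-pred k<i₁)
    ... | inj₂ entry-b = z₁-absent-before-first-z₂ ℓb b≡z₂ q q+1≡z₂ minimal entry-b k (≤-pred k<i₁)

    z₁-absent : ∄[ j ] window j ≡ z₁
    z₁-absent (j , j≡z₁) with j <? i₁
    ... | yes j<i₁ = before j j<i₁ j≡z₁
    ... | no j≮i₁ = after j (≮⇒≥ j≮i₁) j≡z₁

  special≢ordinary : ∀ {j k} → Special j → window j ≡ window k → ¬ Ordinary k
  special≢ordinary (inj₁ j≡z₁) j≡k (≢z₁ , _) = ≢z₁ (trans (sym j≡k) j≡z₁)
  special≢ordinary (inj₂ j≡z₂) j≡k (_ , ≢z₂) = ≢z₂ (trans (sym j≡k) j≡z₂)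

  -- The shorter loop would end at an ordinary window of the longer one.
  loop-forward-shorter : ∀ {wa wb} (ℓa : Loop wa) (ℓb : Loop wb) →
                         Agree u (Loop.start ℓa) (Loop.start ℓb) (n + Loop.period ℓb) → ¬ Loop.period ℓa < Loop.period ℓb
  loop-forward-shorter ℓa ℓb agree Ma<Mb =
    special≢ordinary (Loop.special-start ℓa)
      (trans (sym (Loop.returns ℓa)) (agree⇒window≡-within _ (<⇒≤ Ma<Mb) agree))
      (Loop.ordinary-inside ℓb _ (Loop.period≥1 ℓa) Ma<Mb)

  loop-period-unique : ∀ {wa wb} (ℓa : Loop wa) (ℓb : Loop wb) → window (Loop.start ℓa) ≡ window (Loop.start ℓb) →
                       u (Loop.start ℓa + n) ≡ u (Loop.start ℓb + n) → Loop.period ℓa ≡ Loop.period ℓb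
  loop-period-unique ℓa ℓb same-window same-exit with <-cmp (Loop.period ℓa) (Loop.period ℓb)
  ... | tri≈ _ eq _ = eq
  ... | tri< lt _ _ = ⊥-elim (loop-forward-shorter ℓa ℓb (loop-forward ℓb _ same-window same-exit) lt)
  ... | tri> _ _ gt = ⊥-elim (loop-forward-shorter ℓb ℓa (loop-forward ℓa _ (sym same-window) (sym same-exit)) gt)

  -- Equal periods fix the centres by parity.
  loop-injective : ∀ {wa wb} → OtherPalindrome u n z₁ z₂ wa → OtherPalindrome u n z₁ z₂ wb →
                   (ℓa : Loop wa) (ℓb : Loop wb) → window (Loop.start ℓa) ≡ window (Loop.start ℓb) →
                   u (Loop.start ℓa + n) ≡ u (Loop.start ℓb + n) → wa ≡ wb
  loop-injective {wa} {wb} other-a other-b ℓa ℓb same-window same-exit =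
    at-ext wa wb (trans ∣wa∣ (trans (cong (n +_) δa≡δb) (sym ∣wb∣))) pointwise
    where
    module A = Loop ℓa
    module B = Loop ℓb
    agree-ab : Agree u A.start B.start (n + B.period)
    agree-ab = loop-forward ℓb A.start same-window same-exit
    same-period : A.period ≡ B.period
    same-period = loop-period-unique ℓa ℓb same-window same-exit
    δa = proj₁ (excess wa other-a)
    δb = proj₁ (excess wb other-b)
    ∣wa∣ : length wa ≡ n + δa
    ∣wa∣ = proj₁ (proj₂ (proj₂ (excess wa other-a)))
    ∣wb∣ : length wb ≡ n + δb
    ∣wb∣ = proj₁ (proj₂ (proj₂ (excess wb other-b)))
    split : δa ≡ δb × A.offset ≡ B.offset
    split = parity-split δa δb A.offset B.offset (proj₁ (proj₂ (excess wa other-a))) (proj₁ (proj₂ (excess wb other-b)))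
      (+-cancelˡ-≡ n _ _ (begin
        n + (δa + (A.offset + A.offset))  ≡⟨ +-assoc n δa _ ⟨
        n + δa + (A.offset + A.offset)    ≡⟨ cong (_+ (A.offset + A.offset)) ∣wa∣ ⟨
        length wa + (A.offset + A.offset) ≡⟨ A.centred ⟨
        n + A.period                      ≡⟨ cong (n +_) same-period ⟩
        n + B.period                      ≡⟨ B.centred ⟩
        length wb + (B.offset + B.offset) ≡⟨ cong (_+ (B.offset + B.offset)) ∣wb∣ ⟩
        n + δb + (B.offset + B.offset)    ≡⟨ +-assoc n δb _ ⟩
        n + (δb + (B.offset + B.offset))  ∎))
      where open ≡-Reasoning
    δa≡δb = proj₁ split
    within-loop : ∀ t → t < length wa → A.offset + t < n + B.period
    within-loop t t<∣wa∣ = begin-strict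
      A.offset + t                      <⟨ +-monoʳ-< A.offset t<∣wa∣ ⟩
      A.offset + length wa              ≡⟨ +-comm A.offset (length wa) ⟩
      length wa + A.offset              ≤⟨ +-monoʳ-≤ (length wa) (m≤m+n A.offset A.offset) ⟩
      length wa + (A.offset + A.offset) ≡⟨ A.centred ⟨
      n + A.period                      ≡⟨ cong (n +_) same-period ⟩
      n + B.period                      ∎
      where open ≤-Reasoning
    pointwise : ∀ t → t < length wb → at wa t ≡ at wb t
    pointwise t t<∣wb∣ = begin
      at wa t                        ≡⟨ A.occurs-centre t t<∣wa∣ ⟨
      u (A.start + A.offset + t)     ≡⟨ cong u (+-assoc A.start A.offset t) ⟩
      u (A.start + (A.offset + t))   ≡⟨ agree-ab (A.offset + t) (within-loop t t<∣wa∣) ⟩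
      u (B.start + (A.offset + t))   ≡⟨ cong (λ x → u (B.start + (x + t))) (proj₂ split) ⟩
      u (B.start + (B.offset + t))   ≡⟨ cong u (+-assoc B.start B.offset t) ⟨
      u (B.start + B.offset + t)     ≡⟨ B.occurs-centre t t<∣wb∣ ⟩
      at wb t                        ∎
      where
      open ≡-Reasoning
      t<∣wa∣ : t < length wa
      t<∣wa∣ = subst (t <_) (trans ∣wb∣ (trans (cong (n +_) (sym δa≡δb)) (sym ∣wa∣))) t<∣wb∣

  at-most-one-other-palindrome :
    (∀ x y → Factor u (x ∷ (z₁ ++ [ y ])) → x ≡ y) →
    ∀ r₁ r₂ → r₁ ≢ r₂ → Factor u (z₁ ++ [ r₁ ]) → Factor u (z₁ ++ [ r₂ ]) →
    ∀ e₁ e₂ → LeftExtIn u z₂ e₁ e₂ →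
    ∀ {w₁ w₂} → OtherPalindrome u n z₁ z₂ w₁ → OtherPalindrome u n z₁ z₂ w₂ → w₁ ≡ w₂
  at-most-one-other-palindrome z₁-palindromic r₁ r₂ r₁≢r₂ fr₁ fr₂ e₁ e₂ within other₁ other₂
    with loop _ other₁ | loop _ other₂
  ... | ℓ₁ | ℓ₂ with Loop.special-start ℓ₁ | Loop.special-start ℓ₂
  ... | inj₁ start₁≡z₁ | _ = ⊥-elim (no-loop-at-z₁ z₁-palindromic r₁ r₂ r₁≢r₂ fr₁ fr₂ ℓ₁ start₁≡z₁)
  ... | inj₂ _ | inj₁ start₂≡z₁ = ⊥-elim (no-loop-at-z₁ z₁-palindromic r₁ r₂ r₁≢r₂ fr₁ fr₂ ℓ₂ start₂≡z₁)
  ... | inj₂ start₁≡z₂ | inj₂ start₂≡z₂ with u (Loop.start ℓ₁ + n) ≟ᶠ u (Loop.start ℓ₂ + n)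
  ... | yes same-exit = loop-injective other₁ other₂ ℓ₁ ℓ₂ (trans start₁≡z₂ (sym start₂≡z₂)) same-exit
  ... | no different = ⊥-elim (no-loops-by-both-exits e₁ e₂ within ℓ₁ ℓ₂ start₁≡z₂ start₂≡z₂ different)

  palindrome-count≢4 :
    (∀ x y → Factor u (x ∷ (z₁ ++ [ y ])) → x ≡ y) →
    ∀ r₁ r₂ → r₁ ≢ r₂ → Factor u (z₁ ++ [ r₁ ]) → Factor u (z₁ ++ [ r₂ ]) →
    ∀ e₁ e₂ → LeftExtIn u z₂ e₁ e₂ →
    ∀ A B → PalCount u n A → PalCount u (suc n) B → A + B ≢ 4
  palindrome-count≢4 z₁-palindromic r₁ r₂ r₁≢r₂ fr₁ fr₂ e₁ e₂ within A B count-n count-n+1 A+B≡4 =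
    let _ , _ , w₁≢w₂ , other₁ , other₂ = two-other-palindromes u n z₁ z₂ A B count-n count-n+1 A+B≡4
    in w₁≢w₂ (at-most-one-other-palindrome z₁-palindromic r₁ r₂ r₁≢r₂ fr₁ fr₂ e₁ e₂ within other₁ other₂)

factor? : ∀ (u : InfWord) → (∀ n → Complexity u n (2 * n + 1)) → ∀ w → Dec (Factor u w)
factor? u complexity w with DecMembership._∈?_ _≟ʷ_ w (Listing.elems L)
  where L = listing (complexity (length w))
... | yes w∈ = yes (proj₂ (Listing.sound (listing (complexity (length w))) w w∈))
... | no w∉ = no λ fw → w∉ (Listing.complete (listing (complexity (length w))) w (refl , fw))

module LeftSpecialPalindrome
  (u : InfWord) (complexity : ∀ n → Complexity u n (2 * n + 1)) (closed : ClosedUnderReversal u)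
  (p : Word) (pp : Palindrome p)
  (a b : Letter) (a≢b : a ≢ b) (fap : Factor u (a ∷ p)) (fbp : Factor u (b ∷ p)) (lext-p-in : LeftExtIn u p a b)
  (s : Word) (s≢p : s ≢ p) (∣s∣ : length s ≡ length p)
  (c d : Letter) (c≢d : c ≢ d) (fcs : Factor u (c ∷ s)) (fds : Factor u (d ∷ s)) where

  n : ℕ
  n = length p

  private
    module V₀ = LeftValence u closed complexity n
    module V₁ = LeftValence u closed complexity (suc n)

  fp : Factor u p
  fp = factor-tail u a p fap

  fs : Factor u s
  fs = factor-tail u c s fcs

  p-leftSpecial : LeftSpecial u p
  p-leftSpecial = fp , a , b , a≢b , fap , fbp

  s-leftSpecial : LeftSpecial u s
  s-leftSpecial = fs , c , d , c≢d , fcs , fds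

  rext-p-in : ∀ y → Factor u (p ++ [ y ]) → y ≡ a ⊎ y ≡ b
  rext-p-in y f = lext-p-in y (palindrome-rightExt⇒leftExt u closed y p pp f)

  lext-s-in : LeftExtIn u s c d
  lext-s-in = V₀.leftSpecial-pair⇒leftExtIn s≢p ∣s∣ refl s-leftSpecial p-leftSpecial c d c≢d fcs fds

  others-uniqueLeftExt : ∀ w → length w ≡ n → Factor u w → w ≢ p → w ≢ s → UniqueLeftExt u w
  others-uniqueLeftExt = V₀.leftSpecial-pair⇒uniqueLeftExt (s≢p ∘ sym) refl ∣s∣ p-leftSpecial s-leftSpecial

  s-rightSpecial⇒palindrome : ∀ y y′ → y ≢ y′ → Factor u (s ++ [ y ]) → Factor u (s ++ [ y′ ]) → Palindrome s
  s-rightSpecial⇒palindrome y y′ y≢y′ fy fy′ with reverse s ≟ʷ p | reverse s ≟ʷ s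
  ... | yes s̃≡p | _ = ⊥-elim (s≢p (trans (sym (reverse-involutive s)) (trans (cong reverse s̃≡p) pp)))
  ... | no _ | yes s̃≡s = s̃≡s
  ... | no s̃≢p | no s̃≢s =
    ⊥-elim (y≢y′ (others-uniqueLeftExt (reverse s) (trans (length-reverse s) ∣s∣) (closed s fs) s̃≢p s̃≢s y y′
         (subst (Factor u) (reverse-++-[] s y) (closed _ fy)) (subst (Factor u) (reverse-++-[] s y′) (closed _ fy′))))

  rext-s-in : Palindrome s → ∀ y → Factor u (s ++ [ y ]) → y ≡ c ⊎ y ≡ d
  rext-s-in ps y f = lext-s-in y (palindrome-rightExt⇒leftExt u closed y s ps f)

  lext-s-y-in : ∀ y → LeftExtIn u (s ++ [ y ]) c d
  lext-s-y-in y x fx = lext-s-in x (factor-init u (x ∷ s) y fx)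

  leftSpecial₁-prefix : ∀ v → length v ≡ suc n → LeftSpecial u v → ∃[ y ] (v ≡ p ++ [ y ] ⊎ v ≡ s ++ [ y ])
  leftSpecial₁-prefix v ∣v∣ ls with initLast v
  ... | [] = ⊥-elim (0≢1+n ∣v∣)
  ... | w ∷ʳ′ y with w ≟ʷ p | w ≟ʷ s | ls
  ... | yes refl | _ | _ = y , inj₁ refl
  ... | no _ | yes refl | _ = y , inj₂ refl
  ... | no w≢p | no w≢s | (_ , x , x′ , x≢x′ , fx , fx′) =
    ⊥-elim (x≢x′ (others-uniqueLeftExt w ∣w∣ (factor-tail u x w (factor-init u (x ∷ w) y fx)) w≢p w≢s x x′
                   (factor-init u (x ∷ w) y fx) (factor-init u (x′ ∷ w) y fx′)))
    where
    ∣w∣ : length w ≡ n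
    ∣w∣ = suc-injective (trans (sym (length-++-[] w y)) ∣v∣)

  -- With p ++ [ y ] never left special, the two left special factors of length n + 1 both extend s.
  s-palindromic-extensions : (∀ y → ¬ LeftSpecial u (p ++ [ y ])) →
                             Palindrome s × Factor u (c ∷ (s ++ [ c ])) × Factor u (d ∷ (s ++ [ d ]))
  s-palindromic-extensions p-maximal with V₁.leftSpecial-exists
  ... | v₁ , ∣v₁∣ , ls₁ with leftSpecial₁-prefix v₁ ∣v₁∣ ls₁
  ... | y₁ , inj₁ refl = ⊥-elim (p-maximal y₁ ls₁)
  ... | y₁ , inj₂ refl with V₁.leftSpecial-another (s ++ [ y₁ ]) c d (lext-s-y-in y₁)
  ... | v₂ , v₂≢v₁ , ∣v₂∣ , ls₂ with leftSpecial₁-prefix v₂ ∣v₂∣ ls₂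
  ... | y₂ , inj₁ refl = ⊥-elim (p-maximal y₂ ls₂)
  ... | y₂ , inj₂ refl = ps , proj₁ both-extended , proj₂ both-extended
    where
    y₂≢y₁ : y₂ ≢ y₁
    y₂≢y₁ y₂≡y₁ = v₂≢v₁ (cong (λ y → s ++ [ y ]) y₂≡y₁)
    ps : Palindrome s
    ps = s-rightSpecial⇒palindrome y₂ y₁ y₂≢y₁ (proj₁ ls₂) (proj₁ ls₁)
    ExtendedBy : Letter → Set
    ExtendedBy y = Factor u (c ∷ (s ++ [ y ])) × Factor u (d ∷ (s ++ [ y ]))
    extendedBy : ∀ y → LeftSpecial u (s ++ [ y ]) → ExtendedBy y
    extendedBy y (_ , x , x′ , x≢x′ , fx , fx′) =
      pair-exhausted-by (λ z → Factor u (z ∷ (s ++ [ y ]))) x≢x′ (lext-s-y-in y x fx) (lext-s-y-in y x′ fx′) fx fx′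
    both-extended : Factor u (c ∷ (s ++ [ c ])) × Factor u (d ∷ (s ++ [ d ]))
    both-extended =
      let (csc , _) , (_ , dsd) =
            pair-exhausted-by ExtendedBy y₂≢y₁ (rext-s-in ps y₂ (proj₁ ls₂)) (rext-s-in ps y₁ (proj₁ ls₁))
              (extendedBy y₂ ls₂) (extendedBy y₁ ls₁)
      in csc , dsd

  palindromic-extensions-s : ∀ x → Factor u (x ∷ (s ++ [ x ])) → x ≡ c ⊎ x ≡ d
  palindromic-extensions-s x f = lext-s-in x (factor-init u (x ∷ s) x f)

  part₁ : PalExtCount u p 0 →
          MaximalLeftSpecial u p × ∃[ q ] (Factor u q × Palindrome q × length q ≡ length p × PalExtCount u q 2)
  part₁ no-palindromic-ext = (p-leftSpecial , p-maximal) , s , fs , ps , ∣s∣ , HasCard-2⁺ c≢d csc dsd palindromic-extensions-s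
    where
    -- A left special p ++ [ y ] would make y one of its two left extensions.
    p-maximal : ∀ y → ¬ LeftSpecial u (p ++ [ y ])
    p-maximal y (_ , x , x′ , x≢x′ , fx , fx′)
      with pair-exhausted x≢x′ (lext-p-in x (factor-init u (x ∷ p) y fx)) (lext-p-in x′ (factor-init u (x′ ∷ p) y fx′))
                             (rext-p-in y (factor-tail u x _ fx))
    ... | inj₁ refl = HasCard-0⁻ no-palindromic-ext y fx
    ... | inj₂ refl = HasCard-0⁻ no-palindromic-ext y fx′
    ps-csc-dsd = s-palindromic-extensions p-maximal
    ps = proj₁ ps-csc-dsd
    csc = proj₁ (proj₂ ps-csc-dsd)
    dsd = proj₂ (proj₂ ps-csc-dsd)

  module TwoPalindromicExtensions (A B : ℕ) (count-n : PalCount u n A) (count-n+1 : PalCount u (suc n) B)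
                                  (A+B≡4 : A + B ≡ 4) (a′ b′ : Letter) (a′≢b′ : a′ ≢ b′)
                                  (a′pa′ : Factor u (a′ ∷ (p ++ [ a′ ]))) (b′pb′ : Factor u (b′ ∷ (p ++ [ b′ ]))) where

    lext-p-in′ : LeftExtIn u p a′ b′
    lext-p-in′ x fx = pair-exhausted a′≢b′ (lext-p-in a′ (factor-init u (a′ ∷ p) a′ a′pa′))
                        (lext-p-in b′ (factor-init u (b′ ∷ p) b′ b′pb′)) (lext-p-in x fx)

    -- Without a′ p b′, the right special palindrome p only extends palindromically.
    uncrossed-impossible : ¬ Factor u (a′ ∷ (p ++ [ b′ ])) → ⊥
    uncrossed-impossible ¬a′pb′ =
      TwoSpecialPalindromes.palindrome-count≢4 u closed n p s refl fp pp ps (s≢p ∘ sym) others-uniqueLeftExt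
        p-palindromic a′ b′ a′≢b′ (factor-tail u a′ _ a′pa′) (factor-tail u b′ _ b′pb′) c d lext-s-in
        A B count-n count-n+1 A+B≡4
      where
      p-palindromic : ∀ x y → Factor u (x ∷ (p ++ [ y ])) → x ≡ y
      p-palindromic x y f with lext-p-in′ x (factor-init u (x ∷ p) y f)
                             | lext-p-in′ y (palindrome-rightExt⇒leftExt u closed y p pp (factor-tail u x _ f))
      ... | inj₁ refl | inj₁ refl = refl
      ... | inj₂ refl | inj₂ refl = refl
      ... | inj₁ refl | inj₂ refl = ⊥-elim (¬a′pb′ f)
      ... | inj₂ refl | inj₁ refl = ⊥-elim (¬a′pb′ (palindrome-swapExt u closed b′ p a′ pp f))
      ps : Palindrome s
      ps = proj₁ (s-palindromic-extensions λ y (_ , x , x′ , x≢x′ , fx , fx′) →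
                    x≢x′ (trans (p-palindromic x y fx) (sym (p-palindromic x′ y fx′))))

    module Crossed (a′pb′ : Factor u (a′ ∷ (p ++ [ b′ ]))) where

      pa′-leftSpecial : LeftSpecial u (p ++ [ a′ ])
      pa′-leftSpecial =
        factor-tail u a′ _ a′pa′ , a′ , b′ , a′≢b′ , a′pa′ , palindrome-swapExt u closed a′ p b′ pp a′pb′

      pb′-leftSpecial : LeftSpecial u (p ++ [ b′ ])
      pb′-leftSpecial = factor-tail u a′ _ a′pb′ , a′ , b′ , a′≢b′ , a′pb′ , b′pb′

      s-y-uniqueLeftExt : ∀ y → UniqueLeftExt u (s ++ [ y ])
      s-y-uniqueLeftExt y x x′ fx =
        V₁.leftSpecial-pair⇒uniqueLeftExt (a′≢b′ ∘ ∷ʳ-injectiveʳ p p) (length-++-[] p a′) (length-++-[] p b′)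
          pa′-leftSpecial pb′-leftSpecial (s ++ [ y ]) (trans (length-++-[] s y) (cong suc ∣s∣)) (factor-tail u x _ fx)
          (s≢p ∘ ∷ʳ-injectiveˡ s p) (s≢p ∘ ∷ʳ-injectiveˡ s p) x x′ fx

      -- With c s c and d s d, the right special palindrome s only extends palindromically.
      palindromic-s-impossible : Palindrome s → Factor u (c ∷ (s ++ [ c ])) → Factor u (d ∷ (s ++ [ d ])) → ⊥
      palindromic-s-impossible ps csc dsd =
        TwoSpecialPalindromes.palindrome-count≢4 u closed n s p ∣s∣ fs ps pp s≢p
          (λ w ∣w∣ fw w≢s w≢p → others-uniqueLeftExt w ∣w∣ fw w≢p w≢s)
          s-palindromic c d c≢d (factor-tail u c _ csc) (factor-tail u d _ dsd) a′ b′ lext-p-in′ A B count-n count-n+1 A+B≡4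
        where
        s-palindromic : ∀ x y → Factor u (x ∷ (s ++ [ y ])) → x ≡ y
        s-palindromic x y f with rext-s-in ps y (factor-tail u x _ f)
        ... | inj₁ refl = s-y-uniqueLeftExt c x c f csc
        ... | inj₂ refl = s-y-uniqueLeftExt d x d f dsd

      crossed-s-witness : Palindrome s → Factor u (c ∷ (s ++ [ d ])) → Factor u (d ∷ (s ++ [ c ])) →
                          ∃[ q ] (Factor u q × Palindrome q × length q ≡ length p × PalExtCount u q 0 × MaximalLeftSpecial u q)
      crossed-s-witness ps csd dsc = s , fs , ps , ∣s∣ , HasCard-0⁺ no-palindromic-ext , s-leftSpecial , s-maximal
        where
        no-palindromic-ext : ∀ x → ¬ Factor u (x ∷ (s ++ [ x ]))
        no-palindromic-ext x f with palindromic-extensions-s x f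
        ... | inj₁ refl = c≢d (s-y-uniqueLeftExt c c d f dsc)
        ... | inj₂ refl = c≢d (s-y-uniqueLeftExt d c d csd f)
        s-maximal : ∀ y → ¬ LeftSpecial u (s ++ [ y ])
        s-maximal y (_ , x , x′ , x≢x′ , fx , fx′) = x≢x′ (s-y-uniqueLeftExt y x x′ fx fx′)

      -- The right extensions of c s and d s differ, so s is right special and hence a palindrome.
      crossed : ∃[ q ] (Factor u q × Palindrome q × length q ≡ length p × PalExtCount u q 0 × MaximalLeftSpecial u q)
      crossed with factor-rightExtension u (c ∷ s) fcs | factor-rightExtension u (d ∷ s) fds
      ... | yc , csyc | yd , dsyd with yc ≟ᶠ yd
      ... | yes refl = ⊥-elim (c≢d (s-y-uniqueLeftExt yc c d csyc dsyd))
      ... | no yc≢yd with s-rightSpecial⇒palindrome yc yd yc≢yd (factor-tail u c _ csyc) (factor-tail u d _ dsyd)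
      ... | ps with rext-s-in ps yc (factor-tail u c _ csyc) | rext-s-in ps yd (factor-tail u d _ dsyd)
      ... | inj₁ refl | inj₁ refl = ⊥-elim (yc≢yd refl)
      ... | inj₂ refl | inj₂ refl = ⊥-elim (yc≢yd refl)
      ... | inj₁ refl | inj₂ refl = ⊥-elim (palindromic-s-impossible ps csyc dsyd)
      ... | inj₂ refl | inj₁ refl = crossed-s-witness ps csyc dsyd

    witness : ∃[ q ] (Factor u q × Palindrome q × length q ≡ length p × PalExtCount u q 0 × MaximalLeftSpecial u q)
    witness with factor? u complexity (a′ ∷ (p ++ [ b′ ]))
    ... | no ¬a′pb′ = ⊥-elim (uncrossed-impossible ¬a′pb′)
    ... | yes a′pb′ = Crossed.crossed a′pb′

  part₂ : (∃[ A ] ∃[ B ] (PalCount u (length p) A × PalCount u (length p + 1) B × A + B ≡ 4)) →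
          PalExtCount u p 2 →
          ∃[ q ] (Factor u q × Palindrome q × length q ≡ length p × PalExtCount u q 0 × MaximalLeftSpecial u q)
  part₂ (A , B , count-n , count-n+1 , A+B≡4) two-palindromic-ext =
    let a′ , b′ , a′≢b′ , a′pa′ , b′pb′ , _ = HasCard-2⁻ two-palindromic-ext
    in TwoPalindromicExtensions.witness A B count-n (subst (λ k → PalCount u k B) (+-comm n 1) count-n+1) A+B≡4
         a′ b′ a′≢b′ a′pa′ b′pb′

lemma3 : (u : InfWord)
         → (∀ n → Complexity u n (2 * n + 1))
         → ClosedUnderReversal u
         → (p : Word) → Factor u p → Palindrome p
         → LextCard u p 2
         → (∃[ a ] ∃[ b ] (PalCount u (length p) a × PalCount u (length p + 1) b × a + b ≡ 4))
         → ((PalExtCount u p 0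
              → MaximalLeftSpecial u p
                × ∃[ q ] (Factor u q × Palindrome q × length q ≡ length p × PalExtCount u q 2))
           × (PalExtCount u p 2
              → ∃[ q ] (Factor u q × Palindrome q × length q ≡ length p
                        × PalExtCount u q 0 × MaximalLeftSpecial u q)))
lemma3 u complexity closed p _ pp lext-p counts with HasCard-2⁻ lext-p
... | a , b , a≢b , fap , fbp , lext-p-in
  with LeftValence.leftSpecial-another u closed complexity (length p) p a b lext-p-in
... | s , s≢p , ∣s∣ , (_ , c , d , c≢d , fcs , fds) = part₁ , part₂ counts
  where open LeftSpecialPalindrome u complexity closed p pp a b a≢b fap fbp lext-p-in s s≢p ∣s∣ c d c≢d fcs fds
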